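{- Let $q$ be a prime power and $\mathbb{A}=\mathbb{F}_q[x]$. For non-constant $f\in\mathbb{A}$ let $\Phi(f)=|(\mathbb{A}/f\mathbb{A})^*|$, let $\Phi(\mathbb{A})$ be the set of values of $\Phi$ on non-constant polynomials, and for real $y\ge1$ let $V(y)=|\Phi(\mathbb{A})\cap[1,y]|$. Then $\lim_{y\to\infty}V(y)/y=0$; that is, $\Phi(\mathbb{A})$ has natural density zero in the positive integers. -}

module Defs where

open import Level using (0ℓ)
open import Data.Nat using (ℕ; zero; suc; _≤_; _<_)
open import Data.List using (List; []; _∷_; map; length)
open import Data.List.Relation.Unary.All using (All)
open import Data.List.Relation.Unary.Unique.Propositional using (Unique)
open import Data.List.Membership.Propositional using (_∈_)
open import Data.Vec using (Vec; toList)
open import Data.Product using (Σ; _×_; ∃)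
open import Relation.Nullary using (¬_)
open import Relation.Binary.PropositionalEquality using (_≡_)
open import Algebra.Structures using (IsCommutativeRing)

-- Every finite field is F_q for a prime power q and conversely, so
-- quantifying over all finite fields = quantifying over all prime powers q.

record FiniteField : Set₁ where
  field
    K     : Set
    _+_   : K → K → K
    _*_   : K → K → K
    -_    : K → K
    0#    : K
    1#    : K
    isCommutativeRing : IsCommutativeRing _≡_ _+_ _*_ -_ 0# 1#
    0≢1   : ¬ (0# ≡ 1#)
    inverse : (x : K) → ¬ (x ≡ 0#) → Σ K (λ y → x * y ≡ 1#)
    elements : List K
    complete : (x : K) → x ∈ elements

-- Polynomials A = K[x], as coefficient lists (constant term first),
-- compared up to trailing zero coefficients.

module Poly (F : FiniteField) where
  open FiniteField F

  Pol : Set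
  Pol = List K

  infixl 6 _⊕_
  infixl 7 _⊗_

  _⊕_ : Pol → Pol → Pol
  []       ⊕ q        = q
  (a ∷ p)  ⊕ []       = a ∷ p
  (a ∷ p)  ⊕ (b ∷ q)  = (a + b) ∷ (p ⊕ q)

  negP : Pol → Pol
  negP = map -_

  scale : K → Pol → Pol
  scale c = map (c *_)

  _⊗_ : Pol → Pol → Pol
  []      ⊗ q = []
  (a ∷ p) ⊗ q = scale a q ⊕ (0# ∷ (p ⊗ q))

  oneP : Pol
  oneP = 1# ∷ []

  IsZeroP : Pol → Set
  IsZeroP = All (_≡ 0#)

  _≈P_ : Pol → Pol → Set
  p ≈P q = IsZeroP (p ⊕ negP q)

  coeff : Pol → ℕ → K
  coeff []      _       = 0#
  coeff (a ∷ p) zero    = a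
  coeff (a ∷ p) (suc i) = coeff p i

  HasDegree : Pol → ℕ → Set
  HasDegree f d = ¬ (coeff f d ≡ 0#) × ((j : ℕ) → d < j → coeff f j ≡ 0#)

  -- the class of h is a unit in A / fA : h g = 1 + k f for some g, k ∈ A
  UnitMod : Pol → Pol → Set
  UnitMod f h = Σ Pol λ g → Σ Pol λ k → (h ⊗ g) ≈P (oneP ⊕ (k ⊗ f))

  -- The residue
  -- classes of A / fA are represented (uniquely) by the polynomials of
  -- degree < d, i.e. by coefficient vectors in K^d.  Φ(f) = m means the
  -- units among them are exactly the entries of a duplicate-free list of
  -- length m.
  PhiIs : Pol → ℕ → Set
  PhiIs f m =
    Σ ℕ λ d → 1 ≤ d × HasDegree f d ×
      Σ (List (Vec K d)) λ us →
        Unique us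
        × All (λ h → UnitMod f (toList h)) us
        × ((h : Vec K d) → UnitMod f (toList h) → h ∈ us)
        × length us ≡ m

  InPhiA : ℕ → Set
  InPhiA m = Σ Pol λ f → PhiIs f m

module Submission where

open import Defs
open import Algebra.Core using (Op₂)
open import Data.Nat using (ℕ; suc)
open import Data.Vec using (Vec)
open import Relation.Binary.Definitions using (DecidableEquality)
open import Relation.Unary using (U)

module Counting where

  open import Level using (0ℓ)
  open import Data.Nat using (ℕ; zero; suc; _+_; _*_; _≤_; _<_; z≤n; s≤s)
  open import Data.Nat.Properties using (≤-antisym; +-suc; +-comm; +-monoʳ-≤)
  open import Data.List using (List; []; _∷_; map; length; filter; cartesianProduct; applyUpTo)
  open import Data.List.Properties using (length-map; length-++)
  open import Data.List.Membership.Propositional using (_∈_)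
  open import Data.List.Membership.Propositional.Properties
    using (∈-map⁺; ∈-filter⁺; ∈-cartesianProduct⁺; ∈-cartesianProduct⁻; ∈-applyUpTo⁻)
  open import Data.List.Relation.Binary.Subset.Propositional using (_⊆_)
  open import Data.List.Relation.Unary.Any using (here; there; _─_; any?)
  open import Data.List.Relation.Unary.All as All using (All; []; _∷_)
  open import Data.List.Relation.Unary.All.Properties as All using (all-filter)
  open import Data.List.Relation.Unary.AllPairs using ([]; _∷_)
  open import Data.List.Relation.Unary.Unique.Propositional using (Unique)
  open import Data.List.Relation.Unary.Unique.Propositional.Properties as Unique using ()
  open import Data.Product using (∃; ∃₂; _,_; _×_; proj₂)
  open import Function using (_∘_)
  open import Relation.Binary.Definitions using (DecidableEquality)
  open import Relation.Binary.PropositionalEquality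
    using (_≡_; _≢_; refl; sym; trans; cong; cong₂; subst)
  open import Relation.Nullary using (yes; no; ¬_; ¬?; contradiction)
  open import Relation.Unary using (Pred; U; Decidable; ∁; _∩_; _≐_) renaming (_⊆_ to _⊆ᵖ_)

  record Card {A : Set} (P : Pred A 0ℓ) (n : ℕ) : Set where
    constructor mkCard
    field
      elements : List A
      unique   : Unique elements
      sound    : All P elements
      complete : ∀ {a} → P a → a ∈ elements
      size     : length elements ≡ n

  module _ {A : Set} where

    ∈-─ : ∀ {x z : A} {ys} (x∈ys : x ∈ ys) → z ∈ ys → x ≢ z → z ∈ (ys ─ x∈ys)
    ∈-─ (here refl)  (here refl)  x≢z = contradiction refl x≢z
    ∈-─ (here refl)  (there z∈ys) x≢z = z∈ys
    ∈-─ (there x∈ys) (here refl)  x≢z = here refl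
    ∈-─ (there x∈ys) (there z∈ys) x≢z = there (∈-─ x∈ys z∈ys x≢z)

    length-─ : ∀ {x : A} {ys} (x∈ys : x ∈ ys) → suc (length (ys ─ x∈ys)) ≡ length ys
    length-─ (here refl)  = refl
    length-─ (there x∈ys) = cong suc (length-─ x∈ys)

    length-mono-⊆ : ∀ {xs ys : List A} → Unique xs → xs ⊆ ys → length xs ≤ length ys
    length-mono-⊆ {[]}     _          _     = z≤n
    length-mono-⊆ {x ∷ xs} (x∉xs ∷ u) xs⊆ys = subst (suc (length xs) ≤_) (length-─ x∈ys)
      (s≤s (length-mono-⊆ u λ z∈xs → ∈-─ x∈ys (xs⊆ys (there z∈xs)) (All.lookup x∉xs z∈xs)))
      where x∈ys = xs⊆ys (here refl)

    repetition : DecidableEquality A → ∀ (g : ℕ → A) m → ¬ Unique (applyUpTo g m) →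
                 ∃₂ λ i j → i < j × g i ≡ g j
    repetition _≟_ g zero    not-unique = contradiction [] not-unique
    repetition _≟_ g (suc m) not-unique with any? (g 0 ≟_) (applyUpTo (g ∘ suc) m)
    ... | yes g0∈ = let (k , _ , g0≡) = ∈-applyUpTo⁻ (g ∘ suc) g0∈ in 0 , suc k , s≤s z≤n , g0≡
    ... | no  g0∉ = let (i , j , i<j , gi≡gj) = repetition _≟_ (g ∘ suc) m (not-unique ∘ (g0∉′ ∷_)) in
      suc i , suc j , s≤s i<j , gi≡gj
      where g0∉′ = All.tabulate λ x∈ g0≡x → g0∉ (subst (_∈ _) (sym g0≡x) x∈)

    length≤card : ∀ {P : Pred A 0ℓ} {n xs} → Card P n → Unique xs → All P xs → length xs ≤ n
    length≤card (mkCard _ _ _ c refl) u Pxs = length-mono-⊆ u (c ∘ All.lookup Pxs)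

    card-unique : ∀ {P : Pred A 0ℓ} {m n} → Card P m → Card P n → m ≡ n
    card-unique cP@(mkCard _ u s _ refl) cP′@(mkCard _ u′ s′ _ refl) =
      ≤-antisym (length≤card cP′ u s) (length≤card cP u′ s′)

    card-resp : ∀ {P Q : Pred A 0ℓ} {n} → P ≐ Q → Card P n → Card Q n
    card-resp (P⊆Q , Q⊆P) (mkCard xs u s c e) = mkCard xs u (All.map P⊆Q s) (c ∘ Q⊆P) e

    card-singleton : ∀ {P : Pred A 0ℓ} a → P a → (∀ {b} → P b → b ≡ a) → Card P 1
    card-singleton a Pa only-a = mkCard (a ∷ []) ([] ∷ []) (Pa ∷ []) (here ∘ only-a) refl

    card-pos : ∀ {P : Pred A 0ℓ} {n a} → Card P n → P a → 1 ≤ n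
    card-pos (mkCard (_ ∷ _) _ _ _ refl) _  = s≤s z≤n
    card-pos (mkCard []      _ _ c _)    Pa with () ← c Pa

    length-filter-∁ : ∀ {Q : Pred A 0ℓ} (Q? : Decidable Q) xs →
                      length (filter Q? xs) + length (filter (¬? ∘ Q?) xs) ≡ length xs
    length-filter-∁ Q? []       = refl
    length-filter-∁ Q? (x ∷ xs) with Q? x
    ... | yes _ = cong suc (length-filter-∁ Q? xs)
    ... | no  _ = trans (+-suc _ _) (cong suc (length-filter-∁ Q? xs))

    card-split : ∀ {P Q : Pred A 0ℓ} {n} → Decidable Q → Card P n →
                 ∃₂ λ n₁ n₂ → Card (P ∩ Q) n₁ × Card (P ∩ ∁ Q) n₂ × n₁ + n₂ ≡ n
    card-split {P} {Q} Q? (mkCard xs u s c refl) =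
      _ , _ , restrict Q? , restrict (¬? ∘ Q?) , length-filter-∁ Q? xs
      where
        restrict : ∀ {R : Pred A 0ℓ} (R? : Decidable R) → Card (P ∩ R) (length (filter R? xs))
        restrict R? = mkCard (filter R? xs) (Unique.filter⁺ R? u)
          (All.zip (All.filter⁺ R? s , all-filter R? xs)) (λ (Pa , Ra) → ∈-filter⁺ R? (c Pa) Ra) refl

    card-< : ∀ {P Q : Pred A 0ℓ} {m n a} → Decidable Q → Card P n → Card Q m →
             Q ⊆ᵖ P → P a → ¬ Q a → m < n
    card-< Q? cP cQ Q⊆P Pa ¬Qa with card-split Q? cP
    ... | n₁ , n₂ , cP∩Q , cP∩∁Q , refl =
      subst (_< n₁ + n₂) (card-unique (card-resp (proj₂ , λ Qa → Q⊆P Qa , Qa) cP∩Q) cQ)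
        (subst (_≤ n₁ + n₂) (+-comm n₁ 1) (+-monoʳ-≤ n₁ (card-pos cP∩∁Q (Pa , ¬Qa))))

    card-filter : ∀ {P : Pred A 0ℓ} {N} → Decidable P → Card U N → ∃ λ n → Card P n
    card-filter P? cA with card-split P? cA
    ... | n , _ , cU∩P , _ = n , card-resp (proj₂ , λ Pa → _ , Pa) cU∩P

  module _ {A B : Set} where

    unique-map-on : ∀ {P : Pred A 0ℓ} (φ : A → B) →
                    (∀ {a a′} → P a → P a′ → φ a ≡ φ a′ → a ≡ a′) →
                    ∀ {xs} → Unique xs → All P xs → Unique (map φ xs)
    unique-map-on φ inj []         []         = []
    unique-map-on φ inj (x∉xs ∷ u) (Px ∷ Pxs) =
      All.map⁺ (All.zipWith (λ (x≢y , Py) φx≡φy → x≢y (inj Px Py φx≡φy)) (x∉xs , Pxs))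
      ∷ unique-map-on φ inj u Pxs

    card-map : ∀ {P : Pred A 0ℓ} {Q : Pred B 0ℓ} {n} (φ : A → B) →
               (∀ {a a′} → P a → P a′ → φ a ≡ φ a′ → a ≡ a′) →
               (∀ {a} → P a → Q (φ a)) →
               (∀ {b} → Q b → ∃ λ a → P a × φ a ≡ b) →
               Card P n → Card Q n
    card-map φ inj into onto (mkCard xs u s c e) =
      mkCard (map φ xs) (unique-map-on φ inj u s) (All.map⁺ (All.map into s)) complete
        (trans (length-map φ xs) e)
      where
        complete : ∀ {b} → _ → b ∈ map φ xs
        complete Qb = let (a , Pa , φa≡b) = onto Qb in subst (_∈ map φ xs) φa≡b (∈-map⁺ φ (c Pa))

    length-cartesianProduct : ∀ (xs : List A) (ys : List B) →
                              length (cartesianProduct xs ys) ≡ length xs * length ys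
    length-cartesianProduct []       ys = refl
    length-cartesianProduct (x ∷ xs) ys = trans (length-++ (map (x ,_) ys))
      (cong₂ _+_ (length-map (x ,_) ys) (length-cartesianProduct xs ys))

    card-× : ∀ {P : Pred A 0ℓ} {Q : Pred B 0ℓ} {m n} → Card P m → Card Q n →
             Card (λ (a , b) → P a × Q b) (m * n)
    card-× (mkCard xs u s c refl) (mkCard ys v t d refl) =
      mkCard (cartesianProduct xs ys) (Unique.cartesianProduct⁺ u v) (All.tabulate sound)
        (λ (Pa , Qb) → ∈-cartesianProduct⁺ (c Pa) (d Qb)) (length-cartesianProduct xs ys)
      where
        sound : ∀ {ab} → ab ∈ cartesianProduct xs ys → _
        sound ab∈ = let (a∈ , b∈) = ∈-cartesianProduct⁻ xs ys ab∈ in All.lookup s a∈ , All.lookup t b∈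

module 𝕊-Numbers where

  open import Level using (0ℓ)
  open import Data.Nat using (ℕ; suc; _+_; _*_; _^_; _∸_)
  open import Data.Nat.Properties using (^-distribˡ-+-*; *-identityʳ; *-distribˡ-∸; *-commutativeSemigroup)
  open import Data.Nat.ListAction using (product)
  open import Data.Nat.ListAction.Properties using (product-++)
  open import Data.List using ([]; _∷_; map; _++_)
  open import Data.List.Properties using (map-++)
  open import Data.Product using (∃₂; _,_)
  open import Relation.Binary.PropositionalEquality
  open import Relation.Unary using (Pred)
  open import Algebra.Properties.CommutativeSemigroup *-commutativeSemigroup
    using () renaming (interchange to *-interchange)

  q^suc∸1 : ℕ → ℕ → ℕ
  q^suc∸1 q b = q ^ suc b ∸ 1

  𝕊 : ℕ → Pred ℕ 0ℓ
  𝕊 q m = ∃₂ λ a bs → m ≡ q ^ a * product (map (q^suc∸1 q) bs)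

  𝕊-1 : ∀ q → 𝕊 q 1
  𝕊-1 q = 0 , [] , refl

  𝕊-* : ∀ {q m n} → 𝕊 q m → 𝕊 q n → 𝕊 q (m * n)
  𝕊-* {q} (a , bs , refl) (a′ , bs′ , refl) = a + a′ , bs ++ bs′ , (begin
    q ^ a * ∏ bs * (q ^ a′ * ∏ bs′)     ≡⟨ *-interchange (q ^ a) (∏ bs) (q ^ a′) (∏ bs′) ⟩
    q ^ a * q ^ a′ * (∏ bs * ∏ bs′)     ≡⟨ cong₂ _*_ (^-distribˡ-+-* q a a′) ∏-++ ⟨
    q ^ (a + a′) * ∏ (bs ++ bs′)        ∎)
    where
      open ≡-Reasoning
      ∏ = λ bs → product (map (q^suc∸1 q) bs)
      ∏-++ = trans (cong product (map-++ (q^suc∸1 q) bs bs′)) (product-++ (map (q^suc∸1 q) bs) _)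

  q^j*q^suc∸1∈𝕊 : ∀ q j t → 𝕊 q (q ^ j * q^suc∸1 q t)
  q^j*q^suc∸1∈𝕊 q j t = j , t ∷ [] , cong (q ^ j *_) (sym (*-identityʳ _))

  q^[j+1+t]∸q^j : ∀ q j t → q ^ (j + suc t) ∸ q ^ j ≡ q ^ j * q^suc∸1 q t
  q^[j+1+t]∸q^j q j t = begin
    q ^ (j + suc t) ∸ q ^ j         ≡⟨ cong₂ _∸_ (^-distribˡ-+-* q j (suc t)) (sym (*-identityʳ (q ^ j))) ⟩
    q ^ j * q ^ suc t ∸ q ^ j * 1   ≡⟨ *-distribˡ-∸ (q ^ j) (q ^ suc t) 1 ⟨
    q ^ j * (q ^ suc t ∸ 1)         ∎
    where open ≡-Reasoning

module Density where

  open import Data.Nat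
  open import Data.Nat.Properties
  open import Data.Nat.DivMod using (_/_; m/n*n≤m; /-monoˡ-≤; m*n/n≡m)
  open import Data.Nat.ListAction using (sum; product)
  open import Data.Nat.Tactic.RingSolver using (solve-∀)
  open import Data.List using (List; []; _∷_; map; length; concat; applyUpTo)
  open import Data.List.Properties using (length-map; length-++)
  open import Data.List.Membership.Propositional using (_∈_)
  open import Data.List.Membership.Propositional.Properties using (∈-map⁺; ∈-concat⁺′; ∈-applyUpTo⁺)
  open import Data.List.Relation.Unary.Any using (here; there)
  open import Data.List.Relation.Unary.All as All using (All)
  open import Data.List.Relation.Unary.Unique.Propositional using (Unique)
  open import Data.Product using (∃; ∃₂; _,_; _×_; proj₁; proj₂; uncurry)
  open import Function using (id; _∘_)
  open import Relation.Binary.PropositionalEquality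
  open import Relation.Nullary using (yes; no)
  open import Algebra.Properties.CommutativeSemigroup +-commutativeSemigroup
    using () renaming (interchange to +-interchange)
  open import Algebra.Properties.CommutativeSemigroup *-commutativeSemigroup
    using (x∙yz≈y∙xz; xy∙z≈y∙xz)

  open Counting using (length-mono-⊆)
  open 𝕊-Numbers using (𝕊; q^suc∸1)

  ≤-/ : ∀ {a} b {z} .{{_ : NonZero b}} → a * b ≤ z → a ≤ z / b
  ≤-/ {a} b le = subst (_≤ _ / b) (m*n/n≡m a b) (/-monoˡ-≤ b le)

  n*[m/n]≤m : ∀ m n .{{_ : NonZero n}} → n * (m / n) ≤ m
  n*[m/n]≤m m n = subst (_≤ m) (*-comm (m / n) n) (m/n*n≤m m n)

  n<m^n : ∀ {m} → 2 ≤ m → ∀ n → n < m ^ n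
  n<m^n     2≤m zero    = s≤s z≤n
  n<m^n {m} 2≤m (suc n) = begin-strict
    suc n       ≤⟨ n<m^n 2≤m n ⟩
    m ^ n       <⟨ m<m*n (m ^ n) m 2≤m ⟩
    m ^ n * m   ≡⟨ *-comm (m ^ n) m ⟩
    m ^ suc n   ∎
    where
      open ≤-Reasoning
      instance _ = m^n≢0 m n {{>-nonZero (≤-trans (s≤s z≤n) 2≤m)}}

  length-concat-applyUpTo : ∀ {A : Set} {g : ℕ → List A} {h : ℕ → ℕ} → (∀ t → length (g t) ≡ h t) →
                            ∀ n → length (concat (applyUpTo g n)) ≡ sum (applyUpTo h n)
  length-concat-applyUpTo         eq zero    = refl
  length-concat-applyUpTo {g = g} eq (suc n) =
    trans (length-++ (g 0)) (cong₂ _+_ (eq 0) (length-concat-applyUpTo (eq ∘ suc) n))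

  below : ℕ → ℕ → ℕ
  below Y z with z <? Y
  ... | yes _ = z
  ... | no  _ = 0

  split-at : ∀ {G : ℕ → ℕ} {a b k} Y → (∀ z → G z ≤ b * z) → (∀ z → Y ≤ z → k * G z ≤ a * z) →
             ∀ z → k * G z ≤ a * z + k * b * below Y z
  split-at {G} {a} {b} {k} Y G≤bz large z with z <? Y
  ... | yes _ = begin
    k * G z            ≤⟨ *-monoʳ-≤ k (G≤bz z) ⟩
    k * (b * z)        ≡⟨ *-assoc k b z ⟨
    k * b * z          ≤⟨ m≤n+m _ (a * z) ⟩
    a * z + k * b * z  ∎
    where open ≤-Reasoning
  ... | no z≮Y = ≤-trans (large z (≮⇒≥ z≮Y)) (m≤m+n (a * z) _)

  module GeometricSums (s′ : ℕ) where

    s : ℕ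
    s = suc s′

    infixl 7 _/s^_
    _/s^_ : ℕ → ℕ → ℕ
    z /s^ zero  = z
    z /s^ suc t = (z / s) /s^ t

    ≤-/s^ : ∀ {a} t {z} → a * s ^ t ≤ z → a ≤ z /s^ t
    ≤-/s^ {a} zero          le = subst (_≤ _) (*-identityʳ a) le
    ≤-/s^ {a} (suc t) {z} le = ≤-/s^ t (≤-/ s (subst (_≤ z) a*s^[1+t]≡a*s^t*s le))
      where a*s^[1+t]≡a*s^t*s = trans (cong (a *_) (*-comm s (s ^ t))) (sym (*-assoc a (s ^ t) s))

    Σ/s^ : (ℕ → ℕ) → ℕ → ℕ → ℕ
    Σ/s^ G n z = sum (applyUpTo (λ t → G (z /s^ t)) n)

    module _ {A B : Set} (_⊙_ : ℕ → A → B) where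

      prefixed : (ℕ → List A) → ℕ → ℕ → List B
      prefixed F n z = concat (applyUpTo (λ t → map (t ⊙_) (F (z /s^ t))) n)

      ∈-prefixed : ∀ F {n z t x} → t < n → x ∈ F (z /s^ t) → t ⊙ x ∈ prefixed F n z
      ∈-prefixed F {z = z} {t} t<n x∈ =
        ∈-concat⁺′ (∈-map⁺ (t ⊙_) x∈) (∈-applyUpTo⁺ (λ t → map (t ⊙_) (F (z /s^ t))) t<n)

      length-prefixed : ∀ F n z → length (prefixed F n z) ≡ Σ/s^ (length ∘ F) n z
      length-prefixed F n z = length-concat-applyUpTo (λ t → length-map (t ⊙_) (F (z /s^ t))) n

    Σ/s^-mono : ∀ {G H} → (∀ z → G z ≤ H z) → ∀ n z → Σ/s^ G n z ≤ Σ/s^ H n z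
    Σ/s^-mono G≤H zero    z = z≤n
    Σ/s^-mono G≤H (suc n) z = +-mono-≤ (G≤H z) (Σ/s^-mono G≤H n (z / s))

    Σ/s^-+ : ∀ G H n z → Σ/s^ (λ w → G w + H w) n z ≡ Σ/s^ G n z + Σ/s^ H n z
    Σ/s^-+ G H zero    z = refl
    Σ/s^-+ G H (suc n) z =
      trans (cong (G z + H z +_) (Σ/s^-+ G H n (z / s))) (+-interchange (G z) (H z) _ _)

    Σ/s^-* : ∀ a G n z → Σ/s^ (λ w → a * G w) n z ≡ a * Σ/s^ G n z
    Σ/s^-* a G zero    z = sym (*-zeroʳ a)
    Σ/s^-* a G (suc n) z =
      trans (cong (a * G z +_) (Σ/s^-* a G n (z / s))) (sym (*-distribˡ-+ a (G z) _))

    Σ/s^-id : ∀ n z → s′ * Σ/s^ id n z ≤ s * z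
    Σ/s^-id zero    z = subst (_≤ s * z) (sym (*-zeroʳ s′)) z≤n
    Σ/s^-id (suc n) z = begin
      s′ * (z + Σ/s^ id n (z / s))      ≡⟨ *-distribˡ-+ s′ z _ ⟩
      s′ * z + s′ * Σ/s^ id n (z / s)   ≤⟨ +-monoʳ-≤ (s′ * z) s′*Σ≤z ⟩
      s′ * z + z                        ≡⟨ +-comm (s′ * z) z ⟩
      s * z                             ∎
      where
        open ≤-Reasoning
        s′*Σ≤z = ≤-trans (Σ/s^-id n (z / s)) (n*[m/n]≤m z s)

    module _ (1≤s′ : 1 ≤ s′) where

      Σ/s^-below : ∀ Y n z → Σ/s^ (below Y) n z ≤ 2 * (z ⊓ Y)
      Σ/s^-below Y zero    z = z≤n
      Σ/s^-below Y (suc n) z with z <? Y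
      ... | yes z<Y = begin
        z + Σ/s^ (below Y) n (z / s)   ≤⟨ +-monoʳ-≤ z (Σ/s^-below Y n (z / s)) ⟩
        z + 2 * (z / s ⊓ Y)            ≤⟨ +-monoʳ-≤ z (*-monoʳ-≤ 2 (m⊓n≤m (z / s) Y)) ⟩
        z + 2 * (z / s)                ≤⟨ +-monoʳ-≤ z 2*[z/s]≤z ⟩
        z + z                          ≡⟨ cong (z +_) (+-identityʳ z) ⟨
        2 * z                          ≡⟨ cong (2 *_) (m≤n⇒m⊓n≡m (<⇒≤ z<Y)) ⟨
        2 * (z ⊓ Y)                    ∎
        where
          open ≤-Reasoning
          2*[z/s]≤z = ≤-trans (*-monoˡ-≤ (z / s) (s≤s 1≤s′)) (n*[m/n]≤m z s)
      ... | no z≮Y = begin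
        Σ/s^ (below Y) n (z / s)       ≤⟨ Σ/s^-below Y n (z / s) ⟩
        2 * (z / s ⊓ Y)                ≤⟨ *-monoʳ-≤ 2 (m⊓n≤n (z / s) Y) ⟩
        2 * Y                          ≡⟨ cong (2 *_) (m≥n⇒m⊓n≡n (≮⇒≥ z≮Y)) ⟨
        2 * (z ⊓ Y)                    ∎
        where open ≤-Reasoning

      Σ/s^-split : ∀ {G : ℕ → ℕ} {a b k} Y →
                   (∀ z → G z ≤ b * z) → (∀ z → Y ≤ z → k * G z ≤ a * z) →
                   ∀ n z → k * Σ/s^ G n z ≤ a * Σ/s^ id n z + k * b * (2 * Y)
      Σ/s^-split {G} {a} {b} {k} Y G≤bz large n z = begin
        k * Σ/s^ G n z                                        ≡⟨ Σ/s^-* k G n z ⟨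
        Σ/s^ (λ w → k * G w) n z                              ≤⟨ Σ/s^-mono pointwise n z ⟩
        Σ/s^ (λ w → a * w + k * b * below Y w) n z            ≡⟨ Σ/s^-+ (a *_) (λ w → k * b * below Y w) n z ⟩
        Σ/s^ (a *_) n z + Σ/s^ (λ w → k * b * below Y w) n z  ≡⟨ cong₂ _+_ (Σ/s^-* a id n z)
                                                                          (Σ/s^-* (k * b) (below Y) n z) ⟩
        a * Σ/s^ id n z + k * b * Σ/s^ (below Y) n z          ≤⟨ +-monoʳ-≤ _ Σbelow≤2Y ⟩
        a * Σ/s^ id n z + k * b * (2 * Y)                     ∎
        where
          open ≤-Reasoning
          pointwise = split-at {G} {a} {b} {k} Y G≤bz large
          Σbelow≤2Y = *-monoʳ-≤ (k * b) (≤-trans (Σ/s^-below Y n z) (*-monoʳ-≤ 2 (m⊓n≤n z Y)))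

  module WeightedSequences (r s′ : ℕ) (2≤r : 2 ≤ r) (1≤s′ : 1 ≤ s′)
                           (contraction : 4 * suc s′ ≤ 3 * (s′ * r)) where

    open GeometricSums s′
    module Powers-of-2 = GeometricSums 1

    instance
      r≢0 : NonZero r
      r≢0 = >-nonZero (≤-trans (s≤s z≤n) 2≤r)

    weight : ℕ → ℕ
    weight c = r * s ^ c

    ∏weight : List ℕ → ℕ
    ∏weight cs = product (map weight cs)

    2^length≤∏weight : ∀ cs → 2 ^ length cs ≤ ∏weight cs
    2^length≤∏weight []       = ≤-refl
    2^length≤∏weight (c ∷ cs) =
      *-mono-≤ (≤-trans 2≤r (m≤m*n r (s ^ c) {{m^n≢0 s c}})) (2^length≤∏weight cs)

    1≤∏weight : ∀ cs → 1 ≤ ∏weight cs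
    1≤∏weight cs = ≤-trans (m^n>0 2 (length cs)) (2^length≤∏weight cs)

    seqs : ℕ → ℕ → List (List ℕ)
    seqs zero    y       = []
    seqs (suc n) zero    = []
    seqs (suc n) (suc y) = [] ∷ prefixed _∷_ (seqs n) (suc y) (suc y / r)

    seqs-complete : ∀ n {y cs} → ∏weight cs ≤ y → length cs < n → cs ∈ seqs n y
    seqs-complete (suc n) {zero}  {cs}     P≤0 _ with () ← ≤-trans (1≤∏weight cs) P≤0
    seqs-complete (suc n) {suc y} {[]}     _   _ = here refl
    seqs-complete (suc n) {suc y} {c ∷ cs} P≤y (s≤s |cs|<n) =
      there (∈-prefixed _∷_ (seqs n) c<1+y (seqs-complete n (≤-/s^ c (≤-/ r P*s^c*r≤y)) |cs|<n))
      where
        reverse₃ : ∀ a b c → a * b * c ≡ c * b * a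
        reverse₃ = solve-∀
        P*s^c*r≤y = subst (_≤ suc y) (reverse₃ r (s ^ c) (∏weight cs)) P≤y
        c<1+y : c < suc y
        c<1+y = begin-strict
          c                        <⟨ n<m^n (s≤s 1≤s′) c ⟩
          s ^ c                    ≤⟨ m≤n*m (s ^ c) r ⟩
          r * s ^ c                ≤⟨ m≤m*n (r * s ^ c) (∏weight cs) {{>-nonZero (1≤∏weight cs)}} ⟩
          r * s ^ c * ∏weight cs   ≤⟨ P≤y ⟩
          suc y                    ∎
          where open ≤-Reasoning

    count : ℕ → ℕ → ℕ
    count n y = length (seqs n y)

    count-suc : ∀ n y → count (suc n) (suc y) ≡ suc (Σ/s^ (count n) (suc y) (suc y / r))
    count-suc n y = cong suc (length-prefixed _∷_ (seqs n) (suc y) (suc y / r))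

    4*Σ/s^-id≤3y : ∀ n y → 4 * Σ/s^ id n (y / r) ≤ 3 * y
    4*Σ/s^-id≤3y n y = *-cancelˡ-≤ s′ {{>-nonZero 1≤s′}} (begin
      s′ * (4 * Σ)              ≡⟨ x∙yz≈y∙xz s′ 4 Σ ⟩
      4 * (s′ * Σ)              ≤⟨ *-monoʳ-≤ 4 (Σ/s^-id n (y / r)) ⟩
      4 * (s * (y / r))         ≡⟨ *-assoc 4 s (y / r) ⟨
      4 * s * (y / r)           ≤⟨ *-monoˡ-≤ (y / r) contraction ⟩
      3 * (s′ * r) * (y / r)    ≡⟨ regroup 3 s′ r (y / r) ⟩
      s′ * (3 * (r * (y / r)))  ≤⟨ *-monoʳ-≤ s′ (*-monoʳ-≤ 3 (n*[m/n]≤m y r)) ⟩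
      s′ * (3 * y)              ∎)
      where
        open ≤-Reasoning
        Σ = Σ/s^ id n (y / r)
        regroup : ∀ a b c d → a * (b * c) * d ≡ b * (a * (c * d))
        regroup = solve-∀

    count≤4y : ∀ n y → count n y ≤ 4 * y
    count≤4y zero    y       = z≤n
    count≤4y (suc n) zero    = z≤n
    count≤4y (suc n) (suc y) = begin
      count (suc n) (suc y)                      ≡⟨ count-suc n y ⟩
      suc (Σ/s^ (count n) (suc y) (suc y / r))   ≤⟨ s≤s (Σ/s^-mono (count≤4y n) (suc y) (suc y / r)) ⟩
      suc (Σ/s^ (4 *_) (suc y) (suc y / r))      ≡⟨ cong suc (Σ/s^-* 4 id (suc y) (suc y / r)) ⟩
      suc (4 * Σ/s^ id (suc y) (suc y / r))      ≤⟨ s≤s (4*Σ/s^-id≤3y (suc y) (suc y)) ⟩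
      suc (3 * suc y)                            ≤⟨ +-monoˡ-≤ (3 * suc y) (s≤s (z≤n {y})) ⟩
      4 * suc y                                  ∎
      where open ≤-Reasoning

    k*count-step : ∀ {k} Y → (∀ n z → Y ≤ z → k * count n z ≤ 16 * z) →
                   ∀ n y → k * count (suc n) (suc y) ≤ k + 8 * k * Y + 12 * suc y
    k*count-step {k} Y small n y = begin
      k * count (suc n) (suc y)                   ≡⟨ cong (k *_) (count-suc n y) ⟩
      k * suc Σcount                              ≡⟨ *-suc k Σcount ⟩
      k + k * Σcount                              ≤⟨ +-monoʳ-≤ k (Σ/s^-split 1≤s′ {count n} {16} {4} {k} Y
                                                       (count≤4y n) (small n) (suc y) (suc y / r)) ⟩
      k + (16 * Σid + k * 4 * (2 * Y))            ≤⟨ +-monoʳ-≤ k (+-monoˡ-≤ (k * 4 * (2 * Y)) 16*Σid≤12y) ⟩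
      k + (4 * (3 * suc y) + k * 4 * (2 * Y))     ≡⟨ regroup k (suc y) Y ⟩
      k + 8 * k * Y + 12 * suc y                  ∎
      where
        open ≤-Reasoning
        Σcount = Σ/s^ (count n) (suc y) (suc y / r)
        Σid = Σ/s^ id (suc y) (suc y / r)
        16*Σid≤12y : 16 * Σid ≤ 4 * (3 * suc y)
        16*Σid≤12y = subst (_≤ 4 * (3 * suc y)) (sym (*-assoc 4 4 Σid))
                       (*-monoʳ-≤ 4 (4*Σ/s^-id≤3y (suc y) (suc y)))
        regroup : ∀ k y Y → k + (4 * (3 * y) + k * 4 * (2 * Y)) ≡ k + 8 * k * Y + 12 * y
        regroup = solve-∀

    count-bootstrap : ∀ {k} Y → 4 ≤ k → (∀ n z → Y ≤ z → k * count n z ≤ 16 * z) →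
                      ∀ n y → suc k * (k + 8 * k * Y) ≤ y → suc k * count n y ≤ 16 * y
    count-bootstrap {k} Y 4≤k small zero    y       _     = subst (_≤ 16 * y) (sym (*-zeroʳ (suc k))) z≤n
    count-bootstrap {k} Y 4≤k small (suc n) zero    _     = subst (_≤ 0) (sym (*-zeroʳ (suc k))) z≤n
    count-bootstrap {k} Y 4≤k small (suc n) (suc y) large = *-cancelˡ-≤ k {{k≢0}} (begin
      k * (suc k * C)                 ≡⟨ x∙yz≈y∙xz k (suc k) C ⟩
      suc k * (k * C)                 ≤⟨ *-monoʳ-≤ (suc k) (k*count-step {k} Y small n y) ⟩
      suc k * (A + 12 * y′)           ≡⟨ *-distribˡ-+ (suc k) A (12 * y′) ⟩
      suc k * A + suc k * (12 * y′)   ≤⟨ +-monoˡ-≤ (suc k * (12 * y′)) large ⟩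
      y′ + suc k * (12 * y′)          ≡⟨ collect k y′ ⟩
      (13 + 12 * k) * y′              ≤⟨ *-monoˡ-≤ y′ 13+12k≤16k ⟩
      16 * k * y′                     ≡⟨ xy∙z≈y∙xz 16 k y′ ⟩
      k * (16 * y′)                   ∎)
      where
        open ≤-Reasoning
        k≢0 = >-nonZero (≤-trans (s≤s z≤n) 4≤k)
        y′ = suc y
        C  = count (suc n) y′
        A  = k + 8 * k * Y
        collect : ∀ k y → y + (1 + k) * (12 * y) ≡ (13 + 12 * k) * y
        collect = solve-∀
        13+12k≤16k : 13 + 12 * k ≤ 16 * k
        13+12k≤16k = subst (13 + 12 * k ≤_) (sym (*-distribʳ-+ k 4 12))
          (+-monoˡ-≤ (12 * k) (≤-trans (m≤m+n 13 3) (*-monoʳ-≤ 4 4≤k)))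

    count-sublinear : ∀ j → ∃ λ Y → ∀ n y → Y ≤ y → (4 + j) * count n y ≤ 16 * y
    count-sublinear zero    = 0 , λ n y _ →
      subst (4 * count n y ≤_) (sym (*-assoc 4 4 y)) (*-monoʳ-≤ 4 (count≤4y n y))
    count-sublinear (suc j) = let (Y , small) = count-sublinear j ; k = 4 + j in
      suc k * (k + 8 * k * Y) , count-bootstrap Y (m≤m+n 4 j) small

    representations : ℕ → List (ℕ × List ℕ)
    representations y = Powers-of-2.prefixed _,_ (seqs (suc y)) (suc y) y

    representations-complete : ∀ {y a cs} → 2 ^ a * ∏weight cs ≤ y → (a , cs) ∈ representations y
    representations-complete {y} {a} {cs} le = Powers-of-2.∈-prefixed _,_ (seqs (suc y)) (m≤n⇒m≤1+n a<y)
      (seqs-complete (suc y) (Powers-of-2.≤-/s^ a (subst (_≤ y) (*-comm (2 ^ a) (∏weight cs)) le))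
        (m≤n⇒m≤1+n (<-≤-trans (n<m^n ≤-refl (length cs)) (≤-trans (2^length≤∏weight cs) P≤y))))
      where
        P≤y : ∏weight cs ≤ y
        P≤y = ≤-trans (m≤n*m (∏weight cs) (2 ^ a) {{m^n≢0 2 a}}) le
        a<y : a < y
        a<y = <-≤-trans (n<m^n ≤-refl a)
                (≤-trans (m≤m*n (2 ^ a) (∏weight cs) {{>-nonZero (1≤∏weight cs)}}) le)

    representations-sparse : ∀ k → ∃ λ Y → ∀ y → Y ≤ y → k * length (representations y) ≤ y
    representations-sparse k = 8 * K * Y₀ , bound
      where
        open Powers-of-2 using () renaming (Σ/s^ to Σ/2^; Σ/s^-split to Σ/2^-split; Σ/s^-id to Σ/2^-id;
                                            length-prefixed to length-prefixed₂)
        K  = 4 + 64 * k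
        Y₀ = proj₁ (count-sublinear (64 * k))
        small = proj₂ (count-sublinear (64 * k))
        regroup : ∀ y K Y → 16 * (2 * y) + K * 4 * (2 * Y) ≡ 32 * y + 8 * K * Y
        regroup = solve-∀
        bound : ∀ y → 8 * K * Y₀ ≤ y → k * length (representations y) ≤ y
        bound y large = *-cancelˡ-≤ 64 (begin
          64 * (k * R)                                ≡⟨ *-assoc 64 k R ⟨
          64 * k * R                                  ≤⟨ *-monoˡ-≤ R (m≤n+m (64 * k) 4) ⟩
          K * R                                       ≡⟨ cong (K *_) (length-prefixed₂ _,_ (seqs (suc y)) (suc y) y) ⟩
          K * Σ/2^ (count (suc y)) (suc y) y          ≤⟨ Σ/2^-split ≤-refl {count (suc y)} {16} {4} {K} Y₀
                                                           (count≤4y (suc y)) (small (suc y)) (suc y) y ⟩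
          16 * Σ/2^ id (suc y) y + K * 4 * (2 * Y₀)   ≤⟨ +-monoˡ-≤ _ (*-monoʳ-≤ 16 Σ≤2y) ⟩
          16 * (2 * y) + K * 4 * (2 * Y₀)             ≡⟨ regroup y K Y₀ ⟩
          32 * y + 8 * K * Y₀                         ≤⟨ +-monoʳ-≤ (32 * y) large ⟩
          32 * y + y                                  ≤⟨ +-monoʳ-≤ (32 * y) (m≤n*m y 32) ⟩
          32 * y + 32 * y                             ≡⟨ *-distribʳ-+ y 32 32 ⟨
          64 * y                                      ∎)
          where
            open ≤-Reasoning
            R = length (representations y)
            Σ≤2y : Σ/2^ id (suc y) y ≤ 2 * y
            Σ≤2y = subst (_≤ 2 * y) (*-identityˡ _) (Σ/2^-id (suc y) y)

    sparse : ∀ k → ∃ λ Y → ∀ y → Y ≤ y → (ν : ℕ → List ℕ → ℕ) → ∀ {xs} → Unique xs →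
             (∀ {m} → m ∈ xs → ∃₂ λ a cs → 2 ^ a * ∏weight cs ≤ y × ν a cs ≡ m) →
             k * length xs ≤ y
    sparse k = Y , bound
      where
        Y = proj₁ (representations-sparse k)
        bound : ∀ y → Y ≤ y → (ν : ℕ → List ℕ → ℕ) → ∀ {xs} → Unique xs →
                (∀ {m} → m ∈ xs → ∃₂ λ a cs → 2 ^ a * ∏weight cs ≤ y × ν a cs ≡ m) →
                k * length xs ≤ y
        bound y Y≤y ν {xs} u represented = begin
          k * length xs                                      ≤⟨ *-monoʳ-≤ k (length-mono-⊆ u covered) ⟩
          k * length (map (uncurry ν) (representations y))   ≡⟨ cong (k *_) (length-map _ (representations y)) ⟩
          k * length (representations y)                     ≤⟨ proj₂ (representations-sparse k) y Y≤y ⟩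
          y                                                  ∎
          where
            open ≤-Reasoning
            covered : ∀ {m} → m ∈ xs → m ∈ map (uncurry ν) (representations y)
            covered m∈xs with represented m∈xs
            ... | a , cs , le , refl = ∈-map⁺ (uncurry ν) (representations-complete le)

  product-map-mono : ∀ {f g : ℕ → ℕ} → (∀ b → f b ≤ g b) →
                     ∀ bs → product (map f bs) ≤ product (map g bs)
  product-map-mono f≤g []       = ≤-refl
  product-map-mono f≤g (b ∷ bs) = *-mono-≤ (f≤g b) (product-map-mono f≤g bs)

  2*3^c≤q^suc∸1 : ∀ {q} → 3 ≤ q → ∀ c → 2 * 3 ^ c ≤ q^suc∸1 q c
  2*3^c≤q^suc∸1 {q} 3≤q c = m+n≤o⇒m≤o∸n (2 * 3 ^ c) (begin
    2 * 3 ^ c + 1       ≤⟨ +-monoʳ-≤ (2 * 3 ^ c) (m^n>0 3 c) ⟩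
    2 * 3 ^ c + 3 ^ c   ≡⟨ +-comm (2 * 3 ^ c) (3 ^ c) ⟩
    3 ^ suc c           ≤⟨ ^-monoˡ-≤ (suc c) 3≤q ⟩
    q ^ suc c           ∎)
    where open ≤-Reasoning

  3*2^c≤2^suc[suc]∸1 : ∀ c → 3 * 2 ^ c ≤ q^suc∸1 2 (suc c)
  3*2^c≤2^suc[suc]∸1 c = m+n≤o⇒m≤o∸n (3 * 2 ^ c) (begin
    3 * 2 ^ c + 1       ≤⟨ +-monoʳ-≤ (3 * 2 ^ c) (m^n>0 2 c) ⟩
    3 * 2 ^ c + 2 ^ c   ≡⟨ 3x+x≡2[2x] (2 ^ c) ⟩
    2 ^ suc (suc c)     ∎)
    where
      open ≤-Reasoning
      3x+x≡2[2x] : ∀ x → 3 * x + x ≡ 2 * (2 * x)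
      3x+x≡2[2x] = solve-∀

  nonzero-preds : List ℕ → List ℕ
  nonzero-preds []           = []
  nonzero-preds (zero  ∷ bs) = nonzero-preds bs
  nonzero-preds (suc c ∷ bs) = c ∷ nonzero-preds bs

  product-nonzero-preds : ∀ bs → product (map (q^suc∸1 2) bs) ≡
                                 product (map (q^suc∸1 2 ∘ suc) (nonzero-preds bs))
  product-nonzero-preds []           = refl
  product-nonzero-preds (zero  ∷ bs) = trans (+-identityʳ _) (product-nonzero-preds bs)
  product-nonzero-preds (suc c ∷ bs) = cong (q^suc∸1 2 (suc c) *_) (product-nonzero-preds bs)

  𝕊-value : ℕ → (ℕ → ℕ) → ℕ → List ℕ → ℕ
  𝕊-value q g a bs = q ^ a * product (map g bs)

  𝕊-sparse : ∀ k → ∃ λ Y → ∀ q → 2 ≤ q → ∀ y → Y ≤ y → ∀ {xs} → Unique xs →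
             All (λ m → m ≤ y × 𝕊 q m) xs → k * length xs ≤ y
  𝕊-sparse k = Y₃ ⊔ Y₂ , bound
    where
      module Q≥3 = WeightedSequences 2 2 ≤-refl (s≤s z≤n) ≤-refl
      module Q=2 = WeightedSequences 3 1 (s≤s (s≤s z≤n)) ≤-refl (m≤m+n 8 1)
      Y₃ = proj₁ (Q≥3.sparse k)
      Y₂ = proj₁ (Q=2.sparse k)

      represent₃ : ∀ {q y m} → 3 ≤ q → m ≤ y × 𝕊 q m →
                   ∃₂ λ a bs → 2 ^ a * Q≥3.∏weight bs ≤ y × 𝕊-value q (q^suc∸1 q) a bs ≡ m
      represent₃ 3≤q (m≤y , a , bs , refl) = a , bs ,
        ≤-trans (*-mono-≤ (^-monoˡ-≤ a (<⇒≤ 3≤q)) (product-map-mono (2*3^c≤q^suc∸1 3≤q) bs)) m≤y , refl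

      represent₂ : ∀ {y m} → m ≤ y × 𝕊 2 m →
                   ∃₂ λ a cs → 2 ^ a * Q=2.∏weight cs ≤ y × 𝕊-value 2 (q^suc∸1 2 ∘ suc) a cs ≡ m
      represent₂ {y} (m≤y , a , bs , refl) = a , nonzero-preds bs ,
        ≤-trans (*-monoʳ-≤ (2 ^ a) (product-map-mono 3*2^c≤2^suc[suc]∸1 (nonzero-preds bs)))
          (subst (_≤ y) (cong (2 ^ a *_) (product-nonzero-preds bs)) m≤y) ,
        cong (2 ^ a *_) (sym (product-nonzero-preds bs))

      bound : ∀ q → 2 ≤ q → ∀ y → Y₃ ⊔ Y₂ ≤ y → ∀ {xs} → Unique xs →
              All (λ m → m ≤ y × 𝕊 q m) xs → k * length xs ≤ y
      bound q 2≤q y Y≤y u bounded with q ≟ 2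
      ... | yes refl = proj₂ (Q=2.sparse k) y (≤-trans (m≤n⊔m Y₃ Y₂) Y≤y)
                         (𝕊-value 2 (q^suc∸1 2 ∘ suc)) u (represent₂ ∘ All.lookup bounded)
      ... | no q≢2   = proj₂ (Q≥3.sparse k) y (≤-trans (m≤m⊔n Y₃ Y₂) Y≤y)
                         (𝕊-value q (q^suc∸1 q)) u (represent₃ (≤∧≢⇒< 2≤q (q≢2 ∘ sym)) ∘ All.lookup bounded)

module Polynomials (F : FiniteField) where

  open import Level using (0ℓ)
  open import Data.Nat using (ℕ; zero; suc; _≤_; s≤s)
  open import Data.List using ([]; _∷_; length)
  open import Data.List.Relation.Unary.All using (All; []; _∷_)
  open import Data.Product using (_,_; _×_)
  open import Relation.Binary using (IsEquivalence; Setoid)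
  open import Relation.Binary.PropositionalEquality
  open import Algebra.Bundles using (CommutativeRing; AbelianGroup)
  open import Algebra.Structures using (IsAbelianGroup; IsCommutativeRing)

  open FiniteField F using (0#; 1#; isCommutativeRing)
  open Poly F

  K-ring : CommutativeRing 0ℓ 0ℓ
  K-ring = record { isCommutativeRing = isCommutativeRing }

  open CommutativeRing K-ring using (_+_; _*_; -_; +-assoc; +-comm; +-identityˡ; +-identityʳ;
    -‿inverseʳ; *-identityˡ; zeroˡ; zeroʳ; distribˡ; distribʳ; *-assoc; *-comm)
  import Algebra.Properties.Ring
  import Relation.Binary.Reasoning.Setoid
  open Algebra.Properties.Ring (CommutativeRing.ring K-ring) using (-0#≈0#)

  infix 4 _≋_
  record _≋_ (p q : Pol) : Set where
    constructor coeffwise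
    field coeff-≡ : ∀ i → coeff p i ≡ coeff q i
  open _≋_ public

  ≋-isEquivalence : IsEquivalence _≋_
  ≋-isEquivalence = record
    { refl  = coeffwise λ _ → refl
    ; sym   = λ p≋q → coeffwise λ i → sym (coeff-≡ p≋q i)
    ; trans = λ p≋q q≋r → coeffwise λ i → trans (coeff-≡ p≋q i) (coeff-≡ q≋r i)
    }

  ≋-setoid : Setoid 0ℓ 0ℓ
  ≋-setoid = record { isEquivalence = ≋-isEquivalence }

  open Setoid ≋-setoid public using () renaming (refl to ≋-refl; sym to ≋-sym; trans to ≋-trans)

  ∷-cong : ∀ {a b p q} → a ≡ b → p ≋ q → (a ∷ p) ≋ (b ∷ q)
  ∷-cong a≡b p≋q = coeffwise λ { zero → a≡b ; (suc i) → coeff-≡ p≋q i }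

  coeff-⊕ : ∀ p q i → coeff (p ⊕ q) i ≡ coeff p i + coeff q i
  coeff-⊕ []      q       i       = sym (+-identityˡ _)
  coeff-⊕ (a ∷ p) []      i       = sym (+-identityʳ _)
  coeff-⊕ (a ∷ p) (b ∷ q) zero    = refl
  coeff-⊕ (a ∷ p) (b ∷ q) (suc i) = coeff-⊕ p q i

  coeff-negP : ∀ p i → coeff (negP p) i ≡ - coeff p i
  coeff-negP []      i       = sym -0#≈0#
  coeff-negP (a ∷ p) zero    = refl
  coeff-negP (a ∷ p) (suc i) = coeff-negP p i

  coeff-scale : ∀ c p i → coeff (scale c p) i ≡ c * coeff p i
  coeff-scale c []      i       = sym (zeroʳ c)
  coeff-scale c (a ∷ p) zero    = refl
  coeff-scale c (a ∷ p) (suc i) = coeff-scale c p i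

  ⊕-cong : ∀ {p p′ q q′} → p ≋ p′ → q ≋ q′ → p ⊕ q ≋ p′ ⊕ q′
  ⊕-cong {p} {p′} {q} {q′} p≋p′ q≋q′ = coeffwise λ i → begin
    coeff (p ⊕ q) i           ≡⟨ coeff-⊕ p q i ⟩
    coeff p i + coeff q i     ≡⟨ cong₂ _+_ (coeff-≡ p≋p′ i) (coeff-≡ q≋q′ i) ⟩
    coeff p′ i + coeff q′ i   ≡⟨ coeff-⊕ p′ q′ i ⟨
    coeff (p′ ⊕ q′) i         ∎
    where open ≡-Reasoning

  ⊕-assoc : ∀ p q r → (p ⊕ q) ⊕ r ≋ p ⊕ (q ⊕ r)
  ⊕-assoc p q r = coeffwise λ i → begin
    coeff ((p ⊕ q) ⊕ r) i                 ≡⟨ coeff-⊕ (p ⊕ q) r i ⟩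
    coeff (p ⊕ q) i + coeff r i           ≡⟨ cong (_+ coeff r i) (coeff-⊕ p q i) ⟩
    coeff p i + coeff q i + coeff r i     ≡⟨ +-assoc _ _ _ ⟩
    coeff p i + (coeff q i + coeff r i)   ≡⟨ cong (coeff p i +_) (coeff-⊕ q r i) ⟨
    coeff p i + coeff (q ⊕ r) i           ≡⟨ coeff-⊕ p (q ⊕ r) i ⟨
    coeff (p ⊕ (q ⊕ r)) i                 ∎
    where open ≡-Reasoning

  ⊕-comm : ∀ p q → p ⊕ q ≋ q ⊕ p
  ⊕-comm p q = coeffwise λ i → trans (coeff-⊕ p q i) (trans (+-comm _ _) (sym (coeff-⊕ q p i)))

  ⊕-identityʳ : ∀ p → p ⊕ [] ≋ p
  ⊕-identityʳ p = coeffwise λ i → trans (coeff-⊕ p [] i) (+-identityʳ _)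

  negP-inverseʳ : ∀ p → p ⊕ negP p ≋ []
  negP-inverseʳ p = coeffwise λ i →
    trans (coeff-⊕ p (negP p) i) (trans (cong (coeff p i +_) (coeff-negP p i)) (-‿inverseʳ _))

  negP-cong : ∀ {p q} → p ≋ q → negP p ≋ negP q
  negP-cong {p} {q} p≋q = coeffwise λ i →
    trans (coeff-negP p i) (trans (cong -_ (coeff-≡ p≋q i)) (sym (coeff-negP q i)))

  ⊕-isAbelianGroup : IsAbelianGroup _≋_ _⊕_ [] negP
  ⊕-isAbelianGroup = record
    { isGroup = record
      { isMonoid = record
        { isSemigroup = record
          { isMagma = record { isEquivalence = ≋-isEquivalence ; ∙-cong = ⊕-cong }
          ; assoc   = ⊕-assoc
          }
        ; identity = (λ _ → ≋-refl) , ⊕-identityʳ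
        }
      ; inverse = (λ p → ≋-trans (⊕-comm (negP p) p) (negP-inverseʳ p)) , negP-inverseʳ
      ; ⁻¹-cong = negP-cong
      }
    ; comm = ⊕-comm
    }

  ⊕-abelianGroup : AbelianGroup 0ℓ 0ℓ
  ⊕-abelianGroup = record { isAbelianGroup = ⊕-isAbelianGroup }

  open import Algebra.Properties.CommutativeSemigroup (AbelianGroup.commutativeSemigroup ⊕-abelianGroup)
    using () renaming (interchange to ⊕-interchange; x∙yz≈y∙xz to ⊕-left-comm)
  module ≋-Reasoning = Relation.Binary.Reasoning.Setoid ≋-setoid

  ∷-injective : ∀ {a b p q} → (a ∷ p) ≋ (b ∷ q) → a ≡ b × p ≋ q
  ∷-injective a∷p≋b∷q = coeff-≡ a∷p≋b∷q zero , coeffwise λ i → coeff-≡ a∷p≋b∷q (suc i)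

  ∷≋[] : ∀ {a p} → (a ∷ p) ≋ [] → a ≡ 0# × p ≋ []
  ∷≋[] a∷p≋[] = coeff-≡ a∷p≋[] zero , coeffwise λ i → coeff-≡ a∷p≋[] (suc i)

  0∷-⊕ : ∀ p q → (0# ∷ p) ⊕ (0# ∷ q) ≋ 0# ∷ (p ⊕ q)
  0∷-⊕ p q = ∷-cong (+-identityʳ 0#) ≋-refl

  scale-cong : ∀ {a b p q} → a ≡ b → p ≋ q → scale a p ≋ scale b q
  scale-cong {a} {b} {p} {q} a≡b p≋q = coeffwise λ i →
    trans (coeff-scale a p i) (trans (cong₂ _*_ a≡b (coeff-≡ p≋q i)) (sym (coeff-scale b q i)))

  scale-+ : ∀ a b p → scale (a + b) p ≋ scale a p ⊕ scale b p
  scale-+ a b p = coeffwise λ i → begin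
    coeff (scale (a + b) p) i                        ≡⟨ coeff-scale (a + b) p i ⟩
    (a + b) * coeff p i                              ≡⟨ distribʳ (coeff p i) a b ⟩
    a * coeff p i + b * coeff p i                    ≡⟨ cong₂ _+_ (coeff-scale a p i) (coeff-scale b p i) ⟨
    coeff (scale a p) i + coeff (scale b p) i        ≡⟨ coeff-⊕ (scale a p) (scale b p) i ⟨
    coeff (scale a p ⊕ scale b p) i                  ∎
    where open ≡-Reasoning

  scale-⊕ : ∀ c p q → scale c (p ⊕ q) ≋ scale c p ⊕ scale c q
  scale-⊕ c p q = coeffwise λ i → begin
    coeff (scale c (p ⊕ q)) i                        ≡⟨ coeff-scale c (p ⊕ q) i ⟩
    c * coeff (p ⊕ q) i                              ≡⟨ cong (c *_) (coeff-⊕ p q i) ⟩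
    c * (coeff p i + coeff q i)                      ≡⟨ distribˡ c (coeff p i) (coeff q i) ⟩
    c * coeff p i + c * coeff q i                    ≡⟨ cong₂ _+_ (coeff-scale c p i) (coeff-scale c q i) ⟨
    coeff (scale c p) i + coeff (scale c q) i        ≡⟨ coeff-⊕ (scale c p) (scale c q) i ⟨
    coeff (scale c p ⊕ scale c q) i                  ∎
    where open ≡-Reasoning

  scale-scale : ∀ a b p → scale a (scale b p) ≋ scale (a * b) p
  scale-scale a b p = coeffwise λ i → begin
    coeff (scale a (scale b p)) i    ≡⟨ coeff-scale a (scale b p) i ⟩
    a * coeff (scale b p) i          ≡⟨ cong (a *_) (coeff-scale b p i) ⟩
    a * (b * coeff p i)              ≡⟨ *-assoc a b (coeff p i) ⟨
    a * b * coeff p i                ≡⟨ coeff-scale (a * b) p i ⟨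
    coeff (scale (a * b) p) i        ∎
    where open ≡-Reasoning

  [0]≋[] : 0# ∷ [] ≋ []
  [0]≋[] = coeffwise λ { zero → refl ; (suc i) → refl }

  scale-identity : ∀ p → scale 1# p ≋ p
  scale-identity p = coeffwise λ i → trans (coeff-scale 1# p i) (*-identityˡ _)

  scale-zero : ∀ p → scale 0# p ≋ []
  scale-zero p = coeffwise λ i → trans (coeff-scale 0# p i) (zeroˡ _)

  ⊗-zeroˡ : ∀ {p} q → p ≋ [] → p ⊗ q ≋ []
  ⊗-zeroˡ {[]}    q _    = ≋-refl
  ⊗-zeroˡ {a ∷ p} q a∷p≋[] = let (a≡0 , p≋[]) = ∷≋[] a∷p≋[] in begin
    scale a q ⊕ (0# ∷ p ⊗ q)   ≈⟨ ⊕-cong (scale-cong a≡0 ≋-refl) (∷-cong refl (⊗-zeroˡ q p≋[])) ⟩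
    scale 0# q ⊕ (0# ∷ [])     ≈⟨ ⊕-cong (scale-zero q) [0]≋[] ⟩
    []                         ∎
    where open ≋-Reasoning

  ⊗-congˡ : ∀ {p p′} q → p ≋ p′ → p ⊗ q ≋ p′ ⊗ q
  ⊗-congˡ {[]}    {[]}     q _ = ≋-refl
  ⊗-congˡ {[]}    {b ∷ p′} q []≋b∷p′ = ≋-sym (⊗-zeroˡ q (≋-sym []≋b∷p′))
  ⊗-congˡ {a ∷ p} {[]}     q a∷p≋[] = ⊗-zeroˡ q a∷p≋[]
  ⊗-congˡ {a ∷ p} {b ∷ p′} q a∷p≋b∷p′ = let (a≡b , p≋p′) = ∷-injective a∷p≋b∷p′ in
    ⊕-cong (scale-cong a≡b ≋-refl) (∷-cong refl (⊗-congˡ q p≋p′))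

  ⊗-congʳ : ∀ p {q q′} → q ≋ q′ → p ⊗ q ≋ p ⊗ q′
  ⊗-congʳ []      q≋q′ = ≋-refl
  ⊗-congʳ (a ∷ p) q≋q′ = ⊕-cong (scale-cong refl q≋q′) (∷-cong refl (⊗-congʳ p q≋q′))

  ⊗-cong : ∀ {p p′ q q′} → p ≋ p′ → q ≋ q′ → p ⊗ q ≋ p′ ⊗ q′
  ⊗-cong {p} {p′} {q} p≋p′ q≋q′ = ≋-trans (⊗-congˡ q p≋p′) (⊗-congʳ p′ q≋q′)

  ⊗-distribʳ : ∀ q p p′ → (p ⊕ p′) ⊗ q ≋ p ⊗ q ⊕ p′ ⊗ q
  ⊗-distribʳ q []      p′       = ≋-refl
  ⊗-distribʳ q (a ∷ p) []       = ≋-sym (⊕-identityʳ _)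
  ⊗-distribʳ q (a ∷ p) (b ∷ p′) = begin
    scale (a + b) q ⊕ (0# ∷ (p ⊕ p′) ⊗ q)
      ≈⟨ ⊕-cong (scale-+ a b q) (∷-cong refl (⊗-distribʳ q p p′)) ⟩
    (scale a q ⊕ scale b q) ⊕ (0# ∷ p ⊗ q ⊕ p′ ⊗ q)
      ≈⟨ ⊕-cong ≋-refl (≋-sym (0∷-⊕ (p ⊗ q) (p′ ⊗ q))) ⟩
    (scale a q ⊕ scale b q) ⊕ ((0# ∷ p ⊗ q) ⊕ (0# ∷ p′ ⊗ q))
      ≈⟨ ⊕-interchange (scale a q) (scale b q) (0# ∷ p ⊗ q) (0# ∷ p′ ⊗ q) ⟩
    (scale a q ⊕ (0# ∷ p ⊗ q)) ⊕ (scale b q ⊕ (0# ∷ p′ ⊗ q))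
      ∎
    where open ≋-Reasoning

  scale-⊗ : ∀ c p q → scale c p ⊗ q ≋ scale c (p ⊗ q)
  scale-⊗ c []      q = ≋-refl
  scale-⊗ c (a ∷ p) q = begin
    scale (c * a) q ⊕ (0# ∷ scale c p ⊗ q)
      ≈⟨ ⊕-cong (≋-sym (scale-scale c a q)) (∷-cong (sym (zeroʳ c)) (scale-⊗ c p q)) ⟩
    scale c (scale a q) ⊕ scale c (0# ∷ p ⊗ q)
      ≈⟨ ≋-sym (scale-⊕ c (scale a q) (0# ∷ p ⊗ q)) ⟩
    scale c (scale a q ⊕ (0# ∷ p ⊗ q))
      ∎
    where open ≋-Reasoning

  0∷-⊗ : ∀ p q → (0# ∷ p) ⊗ q ≋ 0# ∷ (p ⊗ q)
  0∷-⊗ p q = ⊕-cong (scale-zero q) ≋-refl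

  ⊗-assoc : ∀ p q r → (p ⊗ q) ⊗ r ≋ p ⊗ (q ⊗ r)
  ⊗-assoc []      q r = ≋-refl
  ⊗-assoc (a ∷ p) q r = begin
    (scale a q ⊕ (0# ∷ p ⊗ q)) ⊗ r              ≈⟨ ⊗-distribʳ r (scale a q) _ ⟩
    scale a q ⊗ r ⊕ (0# ∷ p ⊗ q) ⊗ r            ≈⟨ ⊕-cong (scale-⊗ a q r) (0∷-⊗ (p ⊗ q) r) ⟩
    scale a (q ⊗ r) ⊕ (0# ∷ (p ⊗ q) ⊗ r)        ≈⟨ ⊕-cong ≋-refl (∷-cong refl (⊗-assoc p q r)) ⟩
    scale a (q ⊗ r) ⊕ (0# ∷ p ⊗ (q ⊗ r))        ∎
    where open ≋-Reasoning

  ⊗-zeroʳ : ∀ p → p ⊗ [] ≋ []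
  ⊗-zeroʳ []      = ≋-refl
  ⊗-zeroʳ (a ∷ p) = coeffwise λ { zero → refl ; (suc i) → coeff-≡ (⊗-zeroʳ p) i }

  ⊗-consʳ : ∀ p a q → p ⊗ (a ∷ q) ≋ scale a p ⊕ (0# ∷ p ⊗ q)
  ⊗-consʳ []      a q = coeffwise λ { zero → refl ; (suc i) → refl }
  ⊗-consʳ (b ∷ p) a q = ∷-cong (cong (_+ 0#) (*-comm b a)) (begin
    scale b q ⊕ p ⊗ (a ∷ q)                   ≈⟨ ⊕-cong ≋-refl (⊗-consʳ p a q) ⟩
    scale b q ⊕ (scale a p ⊕ (0# ∷ p ⊗ q))    ≈⟨ ⊕-left-comm (scale b q) (scale a p) _ ⟩
    scale a p ⊕ (scale b q ⊕ (0# ∷ p ⊗ q))    ∎)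
    where open ≋-Reasoning

  ⊗-comm : ∀ p q → p ⊗ q ≋ q ⊗ p
  ⊗-comm []      q = ≋-sym (⊗-zeroʳ q)
  ⊗-comm (a ∷ p) q = ≋-trans (⊕-cong ≋-refl (∷-cong refl (⊗-comm p q))) (≋-sym (⊗-consʳ q a p))

  [c]⊗ : ∀ c p → (c ∷ []) ⊗ p ≋ scale c p
  [c]⊗ c p = ≋-trans (⊕-cong (≋-refl {scale c p}) [0]≋[]) (⊕-identityʳ (scale c p))

  ⊗-identityˡ : ∀ p → oneP ⊗ p ≋ p
  ⊗-identityˡ p = ≋-trans ([c]⊗ 1# p) (scale-identity p)

  Pol-isCommutativeRing : IsCommutativeRing _≋_ _⊕_ _⊗_ negP [] oneP
  Pol-isCommutativeRing = record
    { isRing = record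
      { +-isAbelianGroup = ⊕-isAbelianGroup
      ; *-cong           = ⊗-cong
      ; *-assoc          = ⊗-assoc
      ; *-identity       = ⊗-identityˡ , λ p → ≋-trans (⊗-comm p oneP) (⊗-identityˡ p)
      ; distrib          = (λ p q r → ≋-trans (⊗-comm p (q ⊕ r)) (≋-trans (⊗-distribʳ p q r)
                                        (⊕-cong (⊗-comm q p) (⊗-comm r p))))
                         , ⊗-distribʳ
      }
    ; *-comm = ⊗-comm
    }

  Pol-ring : CommutativeRing 0ℓ 0ℓ
  Pol-ring = record { isCommutativeRing = Pol-isCommutativeRing }

  VanishesFrom : ℕ → Pol → Set
  VanishesFrom n p = ∀ i → n ≤ i → coeff p i ≡ 0#

  vanishes-length : ∀ p → VanishesFrom (length p) p
  vanishes-length []      i       _         = refl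
  vanishes-length (a ∷ p) (suc i) (s≤s n≤i) = vanishes-length p i n≤i

  vanishes-resp-≋ : ∀ {n p q} → p ≋ q → VanishesFrom n p → VanishesFrom n q
  vanishes-resp-≋ p≋q vanish i n≤i = trans (sym (coeff-≡ p≋q i)) (vanish i n≤i)

  All≡0⇒≋[] : ∀ {p} → All (_≡ 0#) p → p ≋ []
  All≡0⇒≋[] []          = ≋-refl
  All≡0⇒≋[] (a≡0 ∷ all) = coeffwise λ { zero → a≡0 ; (suc i) → coeff-≡ (All≡0⇒≋[] all) i }

  ≋[]⇒All≡0 : ∀ {p} → p ≋ [] → All (_≡ 0#) p
  ≋[]⇒All≡0 {[]}    _      = []
  ≋[]⇒All≡0 {a ∷ p} a∷p≋[] = let (a≡0 , p≋[]) = ∷≋[] a∷p≋[] in a≡0 ∷ ≋[]⇒All≡0 p≋[]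

  module PolProperties = Algebra.Properties.Ring (CommutativeRing.ring Pol-ring)

  ≈P⇒≋ : ∀ {p q} → p ≈P q → p ≋ q
  ≈P⇒≋ {p} {q} p-q≈0 = PolProperties.x∙y⁻¹≈ε⇒x≈y p q (All≡0⇒≋[] p-q≈0)

  ≋⇒≈P : ∀ {p q} → p ≋ q → p ≈P q
  ≋⇒≈P p≋q = ≋[]⇒All≡0 (PolProperties.x≈y⇒x∙y⁻¹≈ε p≋q)

  coeff-∷-⊗ : ∀ a k q i → coeff ((a ∷ k) ⊗ q) i ≡ a * coeff q i + coeff (0# ∷ k ⊗ q) i
  coeff-∷-⊗ a k q i = trans (coeff-⊕ (scale a q) (0# ∷ k ⊗ q) i) (cong (_+ _) (coeff-scale a q i))

module CoordinateSpace (F : FiniteField) where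

  open import Level using (0ℓ)
  open import Data.Nat using (ℕ; zero; suc; z≤n; s≤s)
  open import Data.List using ([]; _∷_)
  open import Data.Vec using (Vec; []; _∷_; toList; zipWith; map; replicate)
  open import Data.Vec.Properties using (zipWith-assoc; zipWith-comm; zipWith-identityˡ; zipWith-identityʳ;
    zipWith-inverseˡ; zipWith-inverseʳ; toList-map)
  open import Data.Product using (_,_)
  open import Relation.Binary.PropositionalEquality
  open import Algebra.Bundles using (CommutativeRing; AbelianGroup)
  open import Algebra.Core using (Op₂)
  open import Algebra.Structures using (IsAbelianGroup; IsCommutativeRing)

  open FiniteField F using (K; 0#; 1#)
  open Poly F
  open Polynomials F

  open import Algebra.Properties.Ring (CommutativeRing.ring K-ring) using (-‿distribˡ-*)
  open CommutativeRing K-ring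
    using (_+_; _*_; -_; +-assoc; +-comm; +-identityˡ; +-identityʳ; -‿inverseˡ; -‿inverseʳ; *-identityˡ)

  infixl 6 _+ᵥ_
  infixl 7 _•_

  _+ᵥ_ : ∀ {n} → Vec K n → Vec K n → Vec K n
  _+ᵥ_ = zipWith _+_

  -ᵥ_ : ∀ {n} → Vec K n → Vec K n
  -ᵥ_ = map -_

  0ᵥ : ∀ {n} → Vec K n
  0ᵥ = replicate _ 0#

  _•_ : ∀ {n} → K → Vec K n → Vec K n
  c • v = map (c *_) v

  +ᵥ-isAbelianGroup : ∀ n → IsAbelianGroup _≡_ (_+ᵥ_ {n}) 0ᵥ -ᵥ_
  +ᵥ-isAbelianGroup n = record
    { isGroup = record
      { isMonoid = record
        { isSemigroup = record
          { isMagma = record { isEquivalence = isEquivalence ; ∙-cong = cong₂ _+ᵥ_ }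
          ; assoc   = zipWith-assoc +-assoc
          }
        ; identity = zipWith-identityˡ +-identityˡ , zipWith-identityʳ +-identityʳ
        }
      ; inverse = zipWith-inverseˡ -‿inverseˡ , zipWith-inverseʳ -‿inverseʳ
      ; ⁻¹-cong = cong -ᵥ_
      }
    ; comm = zipWith-comm +-comm
    }

  +ᵥ-abelianGroup : ℕ → AbelianGroup 0ℓ 0ℓ
  +ᵥ-abelianGroup n = record { isAbelianGroup = +ᵥ-isAbelianGroup n }

  toList-+ᵥ : ∀ {n} (v w : Vec K n) → toList (v +ᵥ w) ≡ toList v ⊕ toList w
  toList-+ᵥ []      []      = refl
  toList-+ᵥ (a ∷ v) (b ∷ w) = cong (a + b ∷_) (toList-+ᵥ v w)

  toList-• : ∀ {n} c (v : Vec K n) → toList (c • v) ≡ scale c (toList v)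
  toList-• c = toList-map (c *_)

  toList--ᵥ : ∀ {n} (v : Vec K n) → toList (-ᵥ v) ≡ negP (toList v)
  toList--ᵥ = toList-map -_

  toList-0ᵥ : ∀ n → toList (0ᵥ {n}) ≋ []
  toList-0ᵥ zero    = ≋-refl
  toList-0ᵥ (suc n) = coeffwise λ { zero → refl ; (suc i) → coeff-≡ (toList-0ᵥ n) i }

  toList-vanishes : ∀ {n} (v : Vec K n) → VanishesFrom n (toList v)
  toList-vanishes []      i       _         = refl
  toList-vanishes (a ∷ v) (suc i) (s≤s n≤i) = toList-vanishes v i n≤i

  toList-≋-injective : ∀ {n} {v w : Vec K n} → toList v ≋ toList w → v ≡ w
  toList-≋-injective {v = []}    {[]}    _ = refl
  toList-≋-injective {v = a ∷ v} {b ∷ w} a∷v≋b∷w = let (a≡b , v≋w) = ∷-injective a∷v≋b∷w in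
    cong₂ _∷_ a≡b (toList-≋-injective v≋w)

  truncate : (n : ℕ) → Pol → Vec K n
  truncate zero    p       = []
  truncate (suc n) []      = 0# ∷ truncate n []
  truncate (suc n) (a ∷ p) = a ∷ truncate n p

  toList-truncate : ∀ n {p} → VanishesFrom n p → toList (truncate n p) ≋ p
  toList-truncate zero    {p}     vanish = coeffwise λ i → sym (vanish i z≤n)
  toList-truncate (suc n) {[]}    vanish = coeffwise λ
    { zero → refl ; (suc i) → coeff-≡ (toList-truncate n {[]} λ _ _ → refl) i }
  toList-truncate (suc n) {a ∷ p} vanish =
    ∷-cong refl (toList-truncate n λ i n≤i → vanish (suc i) (s≤s n≤i))

  •-identity : ∀ {n} (v : Vec K n) → 1# • v ≡ v
  •-identity []      = refl
  •-identity (a ∷ v) = cong₂ _∷_ (*-identityˡ a) (•-identity v)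

  -•-distrib : ∀ {n} c (v : Vec K n) → (- c) • v ≡ -ᵥ (c • v)
  -•-distrib c []      = refl
  -•-distrib c (a ∷ v) = cong₂ _∷_ (sym (-‿distribˡ-* c a)) (-•-distrib c v)

  record IsCommutativeAlgebra {d} (_·_ : Op₂ (Vec K d)) (1ₐ : Vec K d) : Set where
    field
      isCommutativeRing : IsCommutativeRing _≡_ _+ᵥ_ _·_ -ᵥ_ 0ᵥ 1ₐ
      •-·-assoc         : ∀ c v w → (c • v) · w ≡ c • (v · w)

module ResidueRing (F : FiniteField) (f : Poly.Pol F) (d′ : ℕ) (deg : Poly.HasDegree F f (suc d′)) where

  open import Level using (0ℓ)
  open import Data.Nat using (zero; z≤n; s≤s)
  import Data.Nat as ℕ
  open import Data.Nat.Properties using (m≤n⇒m<n∨m≡n; m≤n+m)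
  open import Data.List using ([]; _∷_; length)
  open import Data.Vec using (Vec; toList)
  open import Data.Product using (∃; _,_; proj₁; proj₂)
  open import Data.Sum using (inj₁; inj₂)
  open import Function using (case_of_)
  open import Relation.Binary using (IsEquivalence; Setoid)
  open import Relation.Binary.PropositionalEquality
  open import Algebra.Bundles using (CommutativeRing)
  open import Algebra.Structures using (IsCommutativeRing)

  open FiniteField F using (K; 0#; 1#; inverse)
  open Poly F
  open Polynomials F
  import Algebra.Properties.Ring
  import Relation.Binary.Reasoning.Setoid
  open Algebra.Properties.Ring (CommutativeRing.ring K-ring) using (-0#≈0#)
  open CoordinateSpace F

  open CommutativeRing K-ring using (_+_; _*_; -_; +-identityʳ; +-identityˡ; -‿inverseʳ;
    *-identityʳ; *-comm; *-assoc; zeroˡ; zeroʳ)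

  d : ℕ
  d = suc d′

  lc : K
  lc = coeff f d

  lc⁻¹ : K
  lc⁻¹ = proj₁ (inverse lc (proj₁ deg))

  lc*lc⁻¹ : lc * lc⁻¹ ≡ 1#
  lc*lc⁻¹ = proj₂ (inverse lc (proj₁ deg))

  f-vanishes : VanishesFrom (suc d) f
  f-vanishes j = proj₂ deg j

  *lc⁻¹*lc : ∀ x → x * lc⁻¹ * lc ≡ x
  *lc⁻¹*lc x = begin
    x * lc⁻¹ * lc     ≡⟨ *-assoc x lc⁻¹ lc ⟩
    x * (lc⁻¹ * lc)   ≡⟨ cong (x *_) (trans (*-comm lc⁻¹ lc) lc*lc⁻¹) ⟩
    x * 1#            ≡⟨ *-identityʳ x ⟩
    x                 ∎
    where open ≡-Reasoning

  *lc≡0⇒≡0 : ∀ {x} → x * lc ≡ 0# → x ≡ 0#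
  *lc≡0⇒≡0 {x} x*lc≡0 = begin
    x                 ≡⟨ *-identityʳ x ⟨
    x * 1#            ≡⟨ cong (x *_) lc*lc⁻¹ ⟨
    x * (lc * lc⁻¹)   ≡⟨ *-assoc x lc lc⁻¹ ⟨
    x * lc * lc⁻¹     ≡⟨ cong (_* lc⁻¹) x*lc≡0 ⟩
    0# * lc⁻¹         ≡⟨ zeroˡ lc⁻¹ ⟩
    0#                ∎
    where open ≡-Reasoning

  infix 4 _~_
  infix 1 _by_
  record _~_ (p q : Pol) : Set where
    constructor _by_
    field
      quotient : Pol
      quotient-spec : p ≋ q ⊕ quotient ⊗ f

  open PolProperties using (-‿distribˡ-*; //-rightDividesʳ; x≈z//y)
  open import Algebra.Properties.CommutativeSemigroup (CommutativeRing.*-commutativeSemigroup Pol-ring)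
    using () renaming (xy∙z≈xz∙y to ⊗-right-comm)
  open import Algebra.Properties.CommutativeSemigroup (CommutativeRing.+-commutativeSemigroup Pol-ring)
    using () renaming (interchange to ⊕-interchange)

  ≋⇒~ : ∀ {p q} → p ≋ q → p ~ q
  ≋⇒~ {p} {q} p≋q = [] by ≋-trans p≋q (≋-sym (⊕-identityʳ q))

  ~-sym : ∀ {p q} → p ~ q → q ~ p
  ~-sym {p} {q} (k by p≋q+kf) = negP k by (begin
    q                         ≈⟨ //-rightDividesʳ (k ⊗ f) q ⟨
    (q ⊕ k ⊗ f) ⊕ negP (k ⊗ f) ≈⟨ ⊕-cong (≋-sym p≋q+kf) (-‿distribˡ-* k f) ⟩
    p ⊕ negP k ⊗ f            ∎)
    where open ≋-Reasoning

  ~-trans : ∀ {p q r} → p ~ q → q ~ r → p ~ r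
  ~-trans {p} {q} {r} (k by p≋q+kf) (k′ by q≋r+k′f) = k′ ⊕ k by (begin
    p                         ≈⟨ p≋q+kf ⟩
    q ⊕ k ⊗ f                 ≈⟨ ⊕-cong q≋r+k′f ≋-refl ⟩
    (r ⊕ k′ ⊗ f) ⊕ k ⊗ f      ≈⟨ ⊕-assoc r (k′ ⊗ f) (k ⊗ f) ⟩
    r ⊕ (k′ ⊗ f ⊕ k ⊗ f)      ≈⟨ ⊕-cong (≋-refl {r}) (⊗-distribʳ f k′ k) ⟨
    r ⊕ (k′ ⊕ k) ⊗ f          ∎)
    where open ≋-Reasoning

  ~-isEquivalence : IsEquivalence _~_
  ~-isEquivalence = record { refl = ≋⇒~ ≋-refl ; sym = ~-sym ; trans = ~-trans }

  ~-setoid : Setoid 0ℓ 0ℓ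
  ~-setoid = record { isEquivalence = ~-isEquivalence }

  module ~-Reasoning = Relation.Binary.Reasoning.Setoid ~-setoid

  ⊕-cong-~ : ∀ {p p′ q q′} → p ~ p′ → q ~ q′ → p ⊕ q ~ p′ ⊕ q′
  ⊕-cong-~ {p} {p′} {q} {q′} (k by p≋) (k′ by q≋) = k ⊕ k′ by (begin
    p ⊕ q                              ≈⟨ ⊕-cong p≋ q≋ ⟩
    (p′ ⊕ k ⊗ f) ⊕ (q′ ⊕ k′ ⊗ f)       ≈⟨ ⊕-interchange p′ (k ⊗ f) q′ (k′ ⊗ f) ⟩
    (p′ ⊕ q′) ⊕ (k ⊗ f ⊕ k′ ⊗ f)       ≈⟨ ⊕-cong (≋-refl {p′ ⊕ q′}) (⊗-distribʳ f k k′) ⟨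
    (p′ ⊕ q′) ⊕ (k ⊕ k′) ⊗ f           ∎)
    where open ≋-Reasoning

  ⊗-congˡ-~ : ∀ {p p′} q → p ~ p′ → p ⊗ q ~ p′ ⊗ q
  ⊗-congˡ-~ {p} {p′} q (k by p≋) = k ⊗ q by (begin
    p ⊗ q                      ≈⟨ ⊗-congˡ q p≋ ⟩
    (p′ ⊕ k ⊗ f) ⊗ q           ≈⟨ ⊗-distribʳ q p′ (k ⊗ f) ⟩
    p′ ⊗ q ⊕ (k ⊗ f) ⊗ q       ≈⟨ ⊕-cong (≋-refl {p′ ⊗ q}) (⊗-right-comm k f q) ⟩
    p′ ⊗ q ⊕ (k ⊗ q) ⊗ f       ∎)
    where open ≋-Reasoning

  ⊗-cong-~ : ∀ {p p′ q q′} → p ~ p′ → q ~ q′ → p ⊗ q ~ p′ ⊗ q′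
  ⊗-cong-~ {p} {p′} {q} {q′} p~p′ q~q′ = begin
    p ⊗ q      ≈⟨ ⊗-congˡ-~ q p~p′ ⟩
    p′ ⊗ q     ≈⟨ ≋⇒~ (⊗-comm p′ q) ⟩
    q ⊗ p′     ≈⟨ ⊗-congˡ-~ p′ q~q′ ⟩
    q′ ⊗ p′    ≈⟨ ≋⇒~ (⊗-comm q′ p′) ⟩
    p′ ⊗ q′    ∎
    where open ~-Reasoning

  0∷-cong-~ : ∀ {p q} → p ~ q → (0# ∷ p) ~ (0# ∷ q)
  0∷-cong-~ {p} {q} (k by p≋) = 0# ∷ k by (begin
    0# ∷ p                         ≈⟨ ∷-cong refl p≋ ⟩
    0# ∷ (q ⊕ k ⊗ f)               ≈⟨ 0∷-⊕ q (k ⊗ f) ⟨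
    (0# ∷ q) ⊕ (0# ∷ k ⊗ f)        ≈⟨ ⊕-cong (≋-refl {0# ∷ q}) (0∷-⊗ k f) ⟨
    (0# ∷ q) ⊕ (0# ∷ k) ⊗ f        ∎)
    where open ≋-Reasoning

  R : Set
  R = Vec K d

  ⌊_⌋ : R → Pol
  ⌊_⌋ = toList

  overflow : R → K
  overflow r = coeff ⌊ r ⌋ d′ * lc⁻¹

  -- x · r has degree at most d; subtracting (overflow r) · f cancels its coefficient of xᵈ.
  X·_ : R → R
  X· r = truncate d ((0# ∷ ⌊ r ⌋) ⊕ negP (scale (overflow r) f))

  X·-~ : ∀ r → ⌊ X· r ⌋ ~ 0# ∷ ⌊ r ⌋
  X·-~ r = negP (c ∷ []) by
    ≋-trans (toList-truncate d vanish) (⊕-cong (≋-refl {0# ∷ ⌊ r ⌋}) negP[cf]≋[-c]f)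
    where
      c = overflow r
      g = (0# ∷ ⌊ r ⌋) ⊕ negP (scale c f)
      negP[cf]≋[-c]f : negP (scale c f) ≋ negP (c ∷ []) ⊗ f
      negP[cf]≋[-c]f = ≋-trans (negP-cong (≋-sym ([c]⊗ c f))) (-‿distribˡ-* (c ∷ []) f)
      coeff-g : ∀ j → coeff g (suc j) ≡ coeff ⌊ r ⌋ j + - (c * coeff f (suc j))
      coeff-g j = trans (coeff-⊕ (0# ∷ ⌊ r ⌋) (negP (scale c f)) (suc j))
        (cong (coeff ⌊ r ⌋ j +_) (trans (coeff-negP (scale c f) (suc j)) (cong -_ (coeff-scale c f (suc j)))))
      vanish : VanishesFrom d g
      vanish (suc j) (s≤s d′≤j) with m≤n⇒m<n∨m≡n d′≤j
      ... | inj₂ refl = trans (coeff-g d′)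
        (trans (cong (λ y → coeff ⌊ r ⌋ d′ + - y) (*lc⁻¹*lc (coeff ⌊ r ⌋ d′))) (-‿inverseʳ _))
      ... | inj₁ d′<j = trans (coeff-g j)
        (trans (cong₂ (λ x y → x + - (c * y)) (toList-vanishes r j d′<j) (f-vanishes (suc j) (s≤s d′<j)))
          (trans (cong (λ x → 0# + - x) (zeroʳ c)) (trans (+-identityˡ _) -0#≈0#)))

  ι : K → R
  ι a = truncate d (a ∷ [])

  ⌊ι⌋ : ∀ a → ⌊ ι a ⌋ ≋ a ∷ []
  ⌊ι⌋ a = toList-truncate d λ { (suc i) _ → refl }

  reduce : Pol → R
  reduce []      = 0ᵥ
  reduce (a ∷ p) = ι a +ᵥ X· reduce p

  reduce-~ : ∀ p → ⌊ reduce p ⌋ ~ p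
  reduce-~ []      = ≋⇒~ (toList-0ᵥ d)
  reduce-~ (a ∷ p) = begin
    ⌊ ι a +ᵥ X· reduce p ⌋                 ≡⟨ toList-+ᵥ (ι a) (X· reduce p) ⟩
    ⌊ ι a ⌋ ⊕ ⌊ X· reduce p ⌋              ≈⟨ ⊕-cong-~ (≋⇒~ (⌊ι⌋ a)) (X·-~ (reduce p)) ⟩
    (a ∷ []) ⊕ (0# ∷ ⌊ reduce p ⌋)         ≈⟨ ⊕-cong-~ (≋⇒~ (≋-refl {a ∷ []})) (0∷-cong-~ (reduce-~ p)) ⟩
    (a ∷ []) ⊕ (0# ∷ p)                    ≈⟨ ≋⇒~ (∷-cong (+-identityʳ a) ≋-refl) ⟩
    a ∷ p                                  ∎
    where open ~-Reasoning

  coeff-⊗f-top : ∀ k m → VanishesFrom (suc m) k → coeff (k ⊗ f) (m ℕ.+ d) ≡ coeff k m * lc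
  coeff-⊗f-top []      m       _      = sym (zeroˡ lc)
  coeff-⊗f-top (a ∷ k) zero    vanish = trans (coeff-∷-⊗ a k f d)
    (trans (cong (a * lc +_) (coeff-≡ (⊗-zeroˡ f k≋[]) d′)) (+-identityʳ _))
    where
      k≋[] : k ≋ []
      k≋[] = coeffwise λ i → vanish (suc i) (s≤s z≤n)
  coeff-⊗f-top (a ∷ k) (suc m) vanish = trans (coeff-∷-⊗ a k f (suc m ℕ.+ d))
    (trans (cong₂ _+_ (trans (cong (a *_) (f-vanishes (suc m ℕ.+ d) (s≤s (m≤n+m d m)))) (zeroʳ a))
                      (coeff-⊗f-top k m λ i m<i → vanish (suc i) (s≤s m<i)))
           (+-identityˡ _))

  vanishing-multiple : ∀ k → VanishesFrom d (k ⊗ f) → k ≋ []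
  vanishing-multiple k kf-vanishes = from (length k) (vanishes-length k)
    where
      from : ∀ n → VanishesFrom n k → k ≋ []
      from zero    k-vanishes = coeffwise λ i → k-vanishes i z≤n
      from (suc n) k-vanishes = from n λ i n≤i → case m≤n⇒m<n∨m≡n n≤i of λ where
        (inj₁ n<i)  → k-vanishes i n<i
        (inj₂ refl) → *lc≡0⇒≡0
          (trans (sym (coeff-⊗f-top k n k-vanishes)) (kf-vanishes (n ℕ.+ d) (m≤n+m d n)))

  ⌊⌋-injective : ∀ {v w} → ⌊ v ⌋ ~ ⌊ w ⌋ → v ≡ w
  ⌊⌋-injective {v} {w} (k by v≋w+kf) = toList-≋-injective (begin
    ⌊ v ⌋             ≈⟨ v≋w+kf ⟩
    ⌊ w ⌋ ⊕ k ⊗ f     ≈⟨ ⊕-cong (≋-refl {⌊ w ⌋}) (⊗-zeroˡ f (vanishing-multiple k kf-vanishes)) ⟩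
    ⌊ w ⌋ ⊕ []        ≈⟨ ⊕-identityʳ ⌊ w ⌋ ⟩
    ⌊ w ⌋             ∎)
    where
      open ≋-Reasoning
      kf≋v-w : k ⊗ f ≋ ⌊ v ⌋ ⊕ negP ⌊ w ⌋
      kf≋v-w = x≈z//y (k ⊗ f) ⌊ w ⌋ ⌊ v ⌋ (≋-trans (⊕-comm (k ⊗ f) ⌊ w ⌋) (≋-sym v≋w+kf))
      v-w-vanishes : VanishesFrom d (⌊ v ⌋ ⊕ negP ⌊ w ⌋)
      v-w-vanishes = subst (VanishesFrom d) (trans (toList-+ᵥ v (-ᵥ w)) (cong (⌊ v ⌋ ⊕_) (toList--ᵥ w)))
                       (toList-vanishes (v +ᵥ -ᵥ w))
      kf-vanishes = vanishes-resp-≋ (≋-sym kf≋v-w) v-w-vanishes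

  infixl 7 _*ᵣ_
  _*ᵣ_ : R → R → R
  v *ᵣ w = reduce (⌊ v ⌋ ⊗ ⌊ w ⌋)

  1ᵣ : R
  1ᵣ = ι 1#

  ⌊*ᵣ⌋ : ∀ v w → ⌊ v *ᵣ w ⌋ ~ ⌊ v ⌋ ⊗ ⌊ w ⌋
  ⌊*ᵣ⌋ v w = reduce-~ (⌊ v ⌋ ⊗ ⌊ w ⌋)

  module _ where
    open ~-Reasoning

    *ᵣ-comm : ∀ v w → v *ᵣ w ≡ w *ᵣ v
    *ᵣ-comm v w = ⌊⌋-injective (begin
      ⌊ v *ᵣ w ⌋       ≈⟨ ⌊*ᵣ⌋ v w ⟩
      ⌊ v ⌋ ⊗ ⌊ w ⌋    ≈⟨ ≋⇒~ (⊗-comm ⌊ v ⌋ ⌊ w ⌋) ⟩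
      ⌊ w ⌋ ⊗ ⌊ v ⌋    ≈⟨ ⌊*ᵣ⌋ w v ⟨
      ⌊ w *ᵣ v ⌋       ∎)

    *ᵣ-assoc : ∀ u v w → (u *ᵣ v) *ᵣ w ≡ u *ᵣ (v *ᵣ w)
    *ᵣ-assoc u v w = ⌊⌋-injective (begin
      ⌊ (u *ᵣ v) *ᵣ w ⌋            ≈⟨ ⌊*ᵣ⌋ (u *ᵣ v) w ⟩
      ⌊ u *ᵣ v ⌋ ⊗ ⌊ w ⌋           ≈⟨ ⊗-cong-~ (⌊*ᵣ⌋ u v) (≋⇒~ (≋-refl {⌊ w ⌋})) ⟩
      (⌊ u ⌋ ⊗ ⌊ v ⌋) ⊗ ⌊ w ⌋      ≈⟨ ≋⇒~ (⊗-assoc ⌊ u ⌋ ⌊ v ⌋ ⌊ w ⌋) ⟩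
      ⌊ u ⌋ ⊗ (⌊ v ⌋ ⊗ ⌊ w ⌋)      ≈⟨ ⊗-cong-~ (≋⇒~ (≋-refl {⌊ u ⌋})) (⌊*ᵣ⌋ v w) ⟨
      ⌊ u ⌋ ⊗ ⌊ v *ᵣ w ⌋           ≈⟨ ⌊*ᵣ⌋ u (v *ᵣ w) ⟨
      ⌊ u *ᵣ (v *ᵣ w) ⌋            ∎)

    ι-*ᵣ : ∀ c v → ι c *ᵣ v ≡ c • v
    ι-*ᵣ c v = ⌊⌋-injective (begin
      ⌊ ι c *ᵣ v ⌋          ≈⟨ ⌊*ᵣ⌋ (ι c) v ⟩
      ⌊ ι c ⌋ ⊗ ⌊ v ⌋       ≈⟨ ≋⇒~ (⊗-congˡ ⌊ v ⌋ (⌊ι⌋ c)) ⟩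
      (c ∷ []) ⊗ ⌊ v ⌋      ≈⟨ ≋⇒~ ([c]⊗ c ⌊ v ⌋) ⟩
      scale c ⌊ v ⌋         ≡⟨ toList-• c v ⟨
      ⌊ c • v ⌋             ∎)

    *ᵣ-identityˡ : ∀ v → 1ᵣ *ᵣ v ≡ v
    *ᵣ-identityˡ v = trans (ι-*ᵣ 1# v) (•-identity v)

    *ᵣ-distribʳ : ∀ u v w → (v +ᵥ w) *ᵣ u ≡ v *ᵣ u +ᵥ w *ᵣ u
    *ᵣ-distribʳ u v w = ⌊⌋-injective (begin
      ⌊ (v +ᵥ w) *ᵣ u ⌋                       ≈⟨ ⌊*ᵣ⌋ (v +ᵥ w) u ⟩
      ⌊ v +ᵥ w ⌋ ⊗ ⌊ u ⌋                      ≡⟨ cong (_⊗ ⌊ u ⌋) (toList-+ᵥ v w) ⟩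
      (⌊ v ⌋ ⊕ ⌊ w ⌋) ⊗ ⌊ u ⌋                 ≈⟨ ≋⇒~ (⊗-distribʳ ⌊ u ⌋ ⌊ v ⌋ ⌊ w ⌋) ⟩
      ⌊ v ⌋ ⊗ ⌊ u ⌋ ⊕ ⌊ w ⌋ ⊗ ⌊ u ⌋           ≈⟨ ⊕-cong-~ (⌊*ᵣ⌋ v u) (⌊*ᵣ⌋ w u) ⟨
      ⌊ v *ᵣ u ⌋ ⊕ ⌊ w *ᵣ u ⌋                 ≡⟨ toList-+ᵥ (v *ᵣ u) (w *ᵣ u) ⟨
      ⌊ v *ᵣ u +ᵥ w *ᵣ u ⌋                    ∎)

  isCommutativeRing : IsCommutativeRing _≡_ _+ᵥ_ _*ᵣ_ -ᵥ_ 0ᵥ 1ᵣ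
  isCommutativeRing = record
    { isRing = record
      { +-isAbelianGroup = +ᵥ-isAbelianGroup d
      ; *-cong           = cong₂ _*ᵣ_
      ; *-assoc          = *ᵣ-assoc
      ; *-identity       = *ᵣ-identityˡ , λ v → trans (*ᵣ-comm v 1ᵣ) (*ᵣ-identityˡ v)
      ; distrib          = (λ u v w → trans (*ᵣ-comm u (v +ᵥ w)) (trans (*ᵣ-distribʳ u v w)
                                        (cong₂ _+ᵥ_ (*ᵣ-comm v u) (*ᵣ-comm w u))))
                         , *ᵣ-distribʳ
      }
    ; *-comm = *ᵣ-comm
    }

  UnitMod⇒invertible : ∀ {h} → UnitMod f ⌊ h ⌋ → ∃ λ g → h *ᵣ g ≡ 1ᵣ
  UnitMod⇒invertible {h} (g , k , hg≈1+kf) = reduce g , ⌊⌋-injective (begin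
    ⌊ h *ᵣ reduce g ⌋          ≈⟨ ⌊*ᵣ⌋ h (reduce g) ⟩
    ⌊ h ⌋ ⊗ ⌊ reduce g ⌋       ≈⟨ ⊗-cong-~ (≋⇒~ (≋-refl {⌊ h ⌋})) (reduce-~ g) ⟩
    ⌊ h ⌋ ⊗ g                  ≈⟨ k by ≈P⇒≋ hg≈1+kf ⟩
    oneP                       ≈⟨ ≋⇒~ (⌊ι⌋ 1#) ⟨
    ⌊ 1ᵣ ⌋                     ∎)
    where open ~-Reasoning

  invertible⇒UnitMod : ∀ {h} → ∃ (λ g → h *ᵣ g ≡ 1ᵣ) → UnitMod f ⌊ h ⌋
  invertible⇒UnitMod {h} (g , hg≡1) with hg~1
    where
      open ~-Reasoning
      hg~1 : ⌊ h ⌋ ⊗ ⌊ g ⌋ ~ oneP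
      hg~1 = begin
        ⌊ h ⌋ ⊗ ⌊ g ⌋    ≈⟨ ⌊*ᵣ⌋ h g ⟨
        ⌊ h *ᵣ g ⌋       ≡⟨ cong ⌊_⌋ hg≡1 ⟩
        ⌊ 1ᵣ ⌋           ≈⟨ ≋⇒~ (⌊ι⌋ 1#) ⟩
        oneP             ∎
  ... | k by hg≋1+kf = ⌊ g ⌋ , k , ≋⇒≈P hg≋1+kf

  •-*ᵣ-assoc : ∀ c v w → (c • v) *ᵣ w ≡ c • (v *ᵣ w)
  •-*ᵣ-assoc c v w = begin
    (c • v) *ᵣ w       ≡⟨ cong (_*ᵣ w) (ι-*ᵣ c v) ⟨
    (ι c *ᵣ v) *ᵣ w    ≡⟨ *ᵣ-assoc (ι c) v w ⟩
    ι c *ᵣ (v *ᵣ w)    ≡⟨ ι-*ᵣ c (v *ᵣ w) ⟩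
    c • (v *ᵣ w)       ∎
    where open ≡-Reasoning

  isCommutativeAlgebra : IsCommutativeAlgebra _*ᵣ_ 1ᵣ
  isCommutativeAlgebra = record { isCommutativeRing = isCommutativeRing ; •-·-assoc = •-*ᵣ-assoc }

open Counting using (Card)

module FiniteCoordinateSpace (F : FiniteField) (_≟_ : DecidableEquality (FiniteField.K F))
                             (q : ℕ) (card-K : Card {FiniteField.K F} U q) where

  open import Level using (0ℓ)
  import Data.Nat as ℕ
  open import Data.Nat using (zero; suc; _^_)
  open import Data.List.Membership.Propositional using (lose)
  open import Data.List.Relation.Unary.Any using (any?; satisfied)
  open import Data.Vec using (Vec; []; _∷_; head)
  open import Data.Vec.Properties using (∷-injective)
  open import Data.Product using (∃; _,_; _×_; proj₁; proj₂; uncurry)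
  open import Data.Unit using (tt)
  open import Function using (_∘_; id)
  open import Relation.Binary.PropositionalEquality
  open import Relation.Nullary using (Dec; yes; no; ¬_; ¬?; contradiction)
  open import Relation.Nullary.Decidable using (_×-dec_)
  open import Relation.Unary using (Pred; Decidable)
  open import Algebra.Bundles using (CommutativeRing)

  open FiniteField F using (K; 0#; 1#; inverse)
  open Polynomials F using (K-ring)
  open CoordinateSpace F
  open Counting

  open CommutativeRing K-ring using (_+_; _*_; -_; +-identityʳ; *-identityʳ; *-comm; zeroʳ; -‿inverseʳ)

  card-Kⁿ : ∀ n → Card {Vec K n} U (q ^ n)
  card-Kⁿ zero    = card-singleton [] tt λ { {[]} _ → refl }
  card-Kⁿ (suc n) = card-map (λ (a , v) → a ∷ v) (λ _ _ → uncurry (cong₂ _,_) ∘ ∷-injective) (λ _ → tt)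
    (λ { {a ∷ v} _ → (a , v) , (tt , tt) , refl }) (card-× card-K (card-Kⁿ n))

  search : ∀ {n} {P : Pred (Vec K n) 0ℓ} → Decidable P → Dec (∃ P)
  search {n} P? with any? P? (Card.elements (card-Kⁿ n))
  ... | yes found = yes (satisfied found)
  ... | no  none  = no λ (v , Pv) → none (lose (Card.complete (card-Kⁿ n) tt) Pv)

  record IsSubspace {n} (W : Pred (Vec K n) 0ℓ) : Set where
    field
      0ᵥ∈        : W 0ᵥ
      +ᵥ-closed : ∀ {v w} → W v → W w → W (v +ᵥ w)
      •-closed  : ∀ c {v} → W v → W (c • v)

  module _ {n : ℕ} where
    open import Algebra.Properties.AbelianGroup (+ᵥ-abelianGroup n)
      using (xyx⁻¹≈y) renaming (∙-cancelˡ to +ᵥ-cancelˡ)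
    open import Algebra.Structures using (IsAbelianGroup)
    open IsAbelianGroup (+ᵥ-isAbelianGroup n) using () renaming (assoc to +ᵥ-assoc)

    x+ᵥ[y-ᵥx]≡y : ∀ (x y : Vec K n) → x +ᵥ (y +ᵥ -ᵥ x) ≡ y
    x+ᵥ[y-ᵥx]≡y x y = trans (sym (+ᵥ-assoc x y (-ᵥ x))) (xyx⁻¹≈y x y)

    +ᵥ-cancelˡ′ : ∀ x {y z : Vec K n} → x +ᵥ y ≡ x +ᵥ z → y ≡ z
    +ᵥ-cancelˡ′ x = +ᵥ-cancelˡ x _ _

  module _ {n} {W : Pred (Vec K (suc n)) 0ℓ} (W-subspace : IsSubspace W) where

    open IsSubspace W-subspace

    W₀ : Pred (Vec K n) 0ℓ
    W₀ v = W (0# ∷ v)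

    W₀-subspace : IsSubspace W₀
    W₀-subspace = record
      { 0ᵥ∈       = 0ᵥ∈
      ; +ᵥ-closed = λ Wv Ww → subst (λ a → W (a ∷ _)) (+-identityʳ 0#) (+ᵥ-closed Wv Ww)
      ; •-closed  = λ c Wv → subst (λ a → W (a ∷ _)) (zeroʳ c) (•-closed c Wv)
      }

    card-without-pivot : ∀ {m} → ¬ (∃ λ w → W w × head w ≢ 0#) → Card W₀ m → Card W m
    card-without-pivot no-pivot = card-map (0# ∷_) (λ _ _ → proj₂ ∘ ∷-injective) id onto
      where
        onto : ∀ {x} → W x → ∃ λ v → W₀ v × 0# ∷ v ≡ x
        onto {x₀ ∷ xs} Wx with x₀ ≟ 0#
        ... | yes refl = xs , Wx , refl
        ... | no  x₀≢0 = contradiction (x₀ ∷ xs , Wx , x₀≢0) no-pivot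

    card-with-pivot : ∀ {m a as} → W (a ∷ as) → a ≢ 0# → Card W₀ m → Card W (q ℕ.* m)
    card-with-pivot {a = a} {as} Wa a≢0 card-W₀ = card-map φ φ-injective φ-into φ-onto (card-× card-K card-W₀)
      where
        a⁻¹ = proj₁ (inverse a a≢0)
        us = a⁻¹ • as
        a⁻¹a≡1 : a⁻¹ * a ≡ 1#
        a⁻¹a≡1 = trans (*-comm a⁻¹ a) (proj₂ (inverse a a≢0))
        c*a⁻¹a+0≡c : ∀ c → c * (a⁻¹ * a) + 0# ≡ c
        c*a⁻¹a+0≡c c = trans (+-identityʳ _) (trans (cong (c *_) a⁻¹a≡1) (*-identityʳ c))
        φ : K × Vec K n → Vec K (suc n)
        φ (c , v) = c • (a⁻¹ • (a ∷ as)) +ᵥ (0# ∷ v)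
        φ-injective : ∀ {x y} → _ → _ → φ x ≡ φ y → x ≡ y
        φ-injective {c , v} {c′ , v′} _ _ φx≡φy =
          cong₂ _,_ c≡c′ (+ᵥ-cancelˡ′ (c • us) (trans tails (cong (λ b → b • us +ᵥ v′) (sym c≡c′))))
          where
            heads = proj₁ (∷-injective φx≡φy)
            tails = proj₂ (∷-injective φx≡φy)
            c≡c′ = trans (sym (c*a⁻¹a+0≡c c)) (trans heads (c*a⁻¹a+0≡c c′))
        φ-into : ∀ {x} → _ → W (φ x)
        φ-into {c , v} (_ , Wv) = +ᵥ-closed (•-closed c (•-closed a⁻¹ Wa)) Wv
        φ-onto : ∀ {x} → W x → ∃ λ y → (U (proj₁ y) × W₀ (proj₂ y)) × φ y ≡ x
        φ-onto {x₀ ∷ xs} Wx = (x₀ , v) , (tt , W₀v) , cong₂ _∷_ (c*a⁻¹a+0≡c x₀)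
          (trans (cong (λ w → x₀ • us +ᵥ (xs +ᵥ w)) (-•-distrib x₀ us)) (x+ᵥ[y-ᵥx]≡y (x₀ • us) xs))
          where
            v = xs +ᵥ (- x₀) • us
            W₀v : W₀ v
            W₀v = subst (λ b → W (b ∷ v))
              (trans (cong (x₀ +_) (trans (cong (- x₀ *_) a⁻¹a≡1) (*-identityʳ (- x₀)))) (-‿inverseʳ x₀))
              (+ᵥ-closed Wx (•-closed (- x₀) (•-closed a⁻¹ Wa)))

  subspace-card : ∀ {n} {W : Pred (Vec K n) 0ℓ} → Decidable W → IsSubspace W → ∃ λ j → Card W (q ^ j)
  subspace-card {zero} W? W-subspace =
    0 , card-singleton [] (IsSubspace.0ᵥ∈ W-subspace) λ { {[]} _ → refl }
  subspace-card {suc n} {W} W? W-subspace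
    with subspace-card (W? ∘ (0# ∷_)) (W₀-subspace W-subspace)
       | search {P = λ w → W w × head w ≢ 0#} (λ w → W? w ×-dec ¬? (head w ≟ 0#))
  ... | j , card-W₀ | no  no-pivot             = j , card-without-pivot W-subspace no-pivot card-W₀
  ... | j , card-W₀ | yes (a ∷ as , Wa , a≢0) = suc j , card-with-pivot W-subspace Wa a≢0 card-W₀

module FiniteAlgebra (F : FiniteField) (_≟_ : DecidableEquality (FiniteField.K F))
                     (q : ℕ) (card-K : Card {FiniteField.K F} U q)
                     {d : ℕ} (_·_ : Op₂ (Vec (FiniteField.K F) d)) (1ₐ : Vec (FiniteField.K F) d)
                     (isAlgebra : CoordinateSpace.IsCommutativeAlgebra F _·_ 1ₐ) where

  open import Level using (0ℓ)
  import Data.Nat as ℕ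
  open import Data.Nat using (zero; suc; _≤_; _<_; z≤n; s≤s; _^_; _∸_)
  import Data.Nat.Properties as ℕ
  open import Data.List using ([]; applyUpTo)
  open import Data.List.Membership.Propositional using (_∈_)
  open import Data.List.Membership.Propositional.Properties using (∈-applyUpTo⁻)
  open import Data.List.Properties using (length-applyUpTo)
  open import Data.List.Relation.Unary.All as All using (All)
  import Data.List.Relation.Unary.All.Properties as All
  open import Data.List.Relation.Unary.AllPairs using ([]; _∷_)
  open import Data.List.Relation.Unary.Unique.Propositional using (Unique)
  open import Data.Vec.Properties using (≡-dec)
  open import Data.Product using (∃; ∃₂; _,_; _×_; proj₁; proj₂)
  open import Data.Sum using (_⊎_; inj₁; inj₂)
  open import Function using (_∘_)
  open import Relation.Binary.PropositionalEquality
  open import Relation.Nullary using (yes; no; ¬_; ¬?; contradiction)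
  open import Relation.Nullary.Decidable using (_×-dec_)
  open import Relation.Unary using (Pred; Decidable; ∁; _∩_)
  open import Algebra.Bundles using (CommutativeRing)

  open FiniteField F using (K)
  open CoordinateSpace F using (IsCommutativeAlgebra; _+ᵥ_; _•_)
  open FiniteCoordinateSpace F _≟_ q card-K
  open Counting
  open 𝕊-Numbers using (𝕊; 𝕊-1; 𝕊-*; q^j*q^suc∸1∈𝕊; q^suc∸1; q^[j+1+t]∸q^j)
  open IsCommutativeAlgebra isAlgebra renaming (•-·-assoc to •-*)

  instance
    q≢0 : ℕ.NonZero q
    q≢0 = ℕ.>-nonZero (card-pos {a = FiniteField.0# F} card-K _)

  R : Set
  R = Vec K d

  ring : CommutativeRing 0ℓ 0ℓ
  ring = record { isCommutativeRing = isCommutativeRing }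

  open CommutativeRing ring using (_+_; _*_; -_; _-_; 0#; 1#; +-assoc; +-comm; +-identityˡ; +-identityʳ;
    -‿inverseʳ; *-assoc; *-comm; *-identityˡ; distribˡ; distribʳ; zeroˡ; zeroʳ; *-commutativeSemigroup)
  open import Algebra.Properties.Ring (CommutativeRing.ring ring)
    using (x[y-z]≈xy-xz; [y-z]x≈yx-zx; -0#≈0#; \\-leftDividesʳ; x≈z//y; //-rightDividesˡ; +-identityˡ-unique)
  open import Algebra.Properties.CommutativeSemigroup *-commutativeSemigroup
    using () renaming (interchange to *-interchange)

  infix 4 _≟ᵣ_
  _≟ᵣ_ : DecidableEquality R
  _≟ᵣ_ = ≡-dec _≟_

  Idempotent : R → Set
  Idempotent e = e * e ≡ e

  Corner : R → Pred R 0ℓ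
  Corner e v = e * v ≡ v

  InvertibleIn : R → Pred R 0ℓ
  InvertibleIn e v = ∃ λ w → Corner e w × v * w ≡ e

  CornerUnit : R → Pred R 0ℓ
  CornerUnit e = Corner e ∩ InvertibleIn e

  CornerNonUnit : R → Pred R 0ℓ
  CornerNonUnit e = Corner e ∩ ∁ (InvertibleIn e)

  UnitsIn𝕊 : R → Set
  UnitsIn𝕊 e = ∃ λ m → Card (CornerUnit e) m × 𝕊 q m

  Corner? : ∀ e → Decidable (Corner e)
  Corner? e v = e * v ≟ᵣ v

  InvertibleIn? : ∀ e → Decidable (InvertibleIn e)
  InvertibleIn? e v = search λ w → Corner? e w ×-dec (v * w ≟ᵣ e)

  x-0≡x : ∀ x → x - 0# ≡ x
  x-0≡x x = trans (cong (x +_) -0#≈0#) (+-identityʳ x)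

  telescope : ∀ a b c → (a - b) + (c - a) ≡ c - b
  telescope a b c = begin
    (a - b) + (c - a)     ≡⟨ +-comm (a - b) (c - a) ⟩
    (c - a) + (a - b)     ≡⟨ +-assoc c (- a) (a - b) ⟩
    c + (- a + (a - b))   ≡⟨ cong (c +_) (\\-leftDividesʳ a (- b)) ⟩
    c - b                 ∎
    where open ≡-Reasoning

  module _ {e : R} where

    corner-* : ∀ {v} w → Corner e v → Corner e (v * w)
    corner-* {v} w ev≡v = trans (sym (*-assoc e v w)) (cong (_* w) ev≡v)

    corner-• : ∀ c {v} → Corner e v → Corner e (c • v)
    corner-• c {v} ev≡v = begin
      e * (c • v)    ≡⟨ *-comm e (c • v) ⟩
      (c • v) * e    ≡⟨ •-* c v e ⟩
      c • (v * e)    ≡⟨ cong (c •_) (trans (*-comm v e) ev≡v) ⟩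
      c • v          ∎
      where open ≡-Reasoning

    corner-subspace : IsSubspace (Corner e)
    corner-subspace = record
      { 0ᵥ∈       = zeroʳ e
      ; +ᵥ-closed = λ {v} {w} ev≡v ew≡w → trans (distribˡ e v w) (cong₂ _+ᵥ_ ev≡v ew≡w)
      ; •-closed  = corner-•
      }

    corner-⊆ : ∀ {e′} → Corner e e′ → ∀ {v} → Corner e′ v → Corner e v
    corner-⊆ {e′} ee′≡e′ {v} e′v≡v = begin
      e * v          ≡⟨ cong (e *_) e′v≡v ⟨
      e * (e′ * v)   ≡⟨ *-assoc e e′ v ⟨
      e * e′ * v     ≡⟨ cong (_* v) ee′≡e′ ⟩
      e′ * v         ≡⟨ e′v≡v ⟩
      v              ∎
      where open ≡-Reasoning

  module Powers {e : R} (e-idem : Idempotent e) where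

    infixr 8 _^ₑ_
    _^ₑ_ : R → ℕ → R
    a ^ₑ zero  = e
    a ^ₑ suc k = a * a ^ₑ k

    ^ₑ-corner : ∀ {a} → Corner e a → ∀ k → Corner e (a ^ₑ k)
    ^ₑ-corner     ea≡a zero    = e-idem
    ^ₑ-corner {a} ea≡a (suc k) = corner-* (a ^ₑ k) ea≡a

    ^ₑ-+ : ∀ {a} → Corner e a → ∀ m k → a ^ₑ (m ℕ.+ k) ≡ a ^ₑ m * a ^ₑ k
    ^ₑ-+     ea≡a zero    k = sym (^ₑ-corner ea≡a k)
    ^ₑ-+ {a} ea≡a (suc m) k = trans (cong (a *_) (^ₑ-+ ea≡a m k)) (sym (*-assoc a (a ^ₑ m) (a ^ₑ k)))

    ^ₑ-* : ∀ a b k → (a * b) ^ₑ k ≡ a ^ₑ k * b ^ₑ k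
    ^ₑ-* a b zero    = sym e-idem
    ^ₑ-* a b (suc k) = trans (cong ((a * b) *_) (^ₑ-* a b k)) (*-interchange a b (a ^ₑ k) (b ^ₑ k))

    ^ₑ-shift : ∀ {a} → Corner e a → ∀ {i t} → a ^ₑ i ≡ a ^ₑ (i ℕ.+ t) →
               ∀ {m} → i ≤ m → a ^ₑ m ≡ a ^ₑ (m ℕ.+ t)
    ^ₑ-shift {a} ea≡a {i} {t} period {m} i≤m = begin
      a ^ₑ m                        ≡⟨ cong (a ^ₑ_) (ℕ.m∸n+n≡m i≤m) ⟨
      a ^ₑ (m ∸ i ℕ.+ i)            ≡⟨ ^ₑ-+ ea≡a (m ∸ i) i ⟩
      a ^ₑ (m ∸ i) * a ^ₑ i         ≡⟨ cong (a ^ₑ (m ∸ i) *_) period ⟩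
      a ^ₑ (m ∸ i) * a ^ₑ (i ℕ.+ t) ≡⟨ ^ₑ-+ ea≡a (m ∸ i) (i ℕ.+ t) ⟨
      a ^ₑ (m ∸ i ℕ.+ (i ℕ.+ t))    ≡⟨ cong (a ^ₑ_) (ℕ.+-assoc (m ∸ i) i t) ⟨
      a ^ₑ (m ∸ i ℕ.+ i ℕ.+ t)      ≡⟨ cong (λ x → a ^ₑ (x ℕ.+ t)) (ℕ.m∸n+n≡m i≤m) ⟩
      a ^ₑ (m ℕ.+ t)                ∎
      where open ≡-Reasoning

    ^ₑ-periodic : ∀ {a} → Corner e a → ∀ {i t} → a ^ₑ i ≡ a ^ₑ (i ℕ.+ t) →
                  ∀ {m} → i ≤ m → ∀ y → a ^ₑ m ≡ a ^ₑ (m ℕ.+ y ℕ.* t)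
    ^ₑ-periodic {a} ea≡a period {m} i≤m zero    = cong (a ^ₑ_) (sym (ℕ.+-identityʳ m))
    ^ₑ-periodic {a} ea≡a {t = t} period {m} i≤m (suc y) = begin
      a ^ₑ m                        ≡⟨ ^ₑ-periodic ea≡a period i≤m y ⟩
      a ^ₑ (m ℕ.+ y ℕ.* t)          ≡⟨ ^ₑ-shift ea≡a period (ℕ.≤-trans i≤m (ℕ.m≤m+n m (y ℕ.* t))) ⟩
      a ^ₑ (m ℕ.+ y ℕ.* t ℕ.+ t)    ≡⟨ cong (a ^ₑ_) (ℕ.+-assoc m (y ℕ.* t) t) ⟩
      a ^ₑ (m ℕ.+ (y ℕ.* t ℕ.+ t))  ≡⟨ cong (λ x → a ^ₑ (m ℕ.+ x)) (ℕ.+-comm (y ℕ.* t) t) ⟩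
      a ^ₑ (m ℕ.+ suc y ℕ.* t)      ∎
      where open ≡-Reasoning

    powers-repeat : ∀ {a n} → Corner e a → Card (Corner e) n →
                    ∃₂ λ i t → a ^ₑ i ≡ a ^ₑ (i ℕ.+ suc t)
    powers-repeat {a} {n} ea≡a card-eR with repetition _≟ᵣ_ (a ^ₑ_) (suc n) too-many
      where
        too-many : ¬ Unique (applyUpTo (a ^ₑ_) (suc n))
        too-many unique = ℕ.n≮n n (subst (_≤ n) (length-applyUpTo (a ^ₑ_) (suc n))
          (length≤card card-eR unique (All.applyUpTo⁺₁ (a ^ₑ_) (suc n) λ {k} _ → ^ₑ-corner ea≡a k)))
    ... | i , j , i<j , aⁱ≡aʲ with ℕ.m≤n⇒∃[o]m+o≡n i<j
    ...   | t , refl = i , t , trans aⁱ≡aʲ (cong (a ^ₑ_) (sym (ℕ.+-suc i t)))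

    idempotent-power : ∀ {a n} → Corner e a → Card (Corner e) n → ∃ λ N → Idempotent (a ^ₑ suc N)
    idempotent-power {a} ea≡a card-eR with powers-repeat ea≡a card-eR
    ... | i , t , period = t ℕ.+ i ℕ.* suc t , (begin
      a ^ₑ N * a ^ₑ N               ≡⟨ ^ₑ-+ ea≡a N N ⟨
      a ^ₑ (N ℕ.+ suc i ℕ.* suc t)  ≡⟨ ^ₑ-periodic ea≡a period i≤N (suc i) ⟨
      a ^ₑ N                        ∎)
      where
        open ≡-Reasoning
        N = suc i ℕ.* suc t
        i≤N : i ≤ N
        i≤N = ℕ.≤-trans (ℕ.n≤1+n i) (ℕ.m≤m*n (suc i) (suc t))

  module Local {e : R} (e-idem : Idempotent e) (e≢0 : e ≢ 0#)
               (only-trivial : ∀ {e′} → Corner e e′ → Idempotent e′ → e′ ≡ 0# ⊎ e′ ≡ e)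
               {n} (card-eR : Card (Corner e) n) where

    open Powers e-idem

    nonunit-nilpotent : ∀ {a} → CornerNonUnit e a → ∃ λ N → a ^ₑ N ≡ 0#
    nonunit-nilpotent {a} (ea≡a , a-nonunit) = nilpotent (idempotent-power ea≡a card-eR)
      where
        nilpotent : (∃ λ N → Idempotent (a ^ₑ suc N)) → ∃ λ N → a ^ₑ N ≡ 0#
        nilpotent (N , idem) with only-trivial (^ₑ-corner ea≡a (suc N)) idem
        ... | inj₁ aᴺ≡0 = suc N , aᴺ≡0
        ... | inj₂ aᴺ≡e = contradiction (a ^ₑ N , ^ₑ-corner ea≡a N , aᴺ≡e) a-nonunit

    geometric-sum : ∀ {y} → Corner e y → ∀ k → ∃ λ G → Corner e G × (e - y) * G ≡ e - y ^ₑ k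
    geometric-sum     ey≡y zero    = 0# , zeroʳ e , trans (zeroʳ (e - _)) (sym (-‿inverseʳ e))
    geometric-sum {y} ey≡y (suc k) with geometric-sum ey≡y k
    ... | G , eG≡G , [e-y]G≡e-yᵏ = y ^ₑ k + G , corner-subspace′ , (begin
      (e - y) * (y ^ₑ k + G)                        ≡⟨ distribˡ (e - y) (y ^ₑ k) G ⟩
      (e - y) * y ^ₑ k + (e - y) * G                ≡⟨ cong₂ _+_ ([y-z]x≈yx-zx (y ^ₑ k) e y) [e-y]G≡e-yᵏ ⟩
      (e * y ^ₑ k - y ^ₑ suc k) + (e - y ^ₑ k)      ≡⟨ cong (λ z → (z - y ^ₑ suc k) + (e - y ^ₑ k)) (^ₑ-corner ey≡y k) ⟩
      (y ^ₑ k - y ^ₑ suc k) + (e - y ^ₑ k)          ≡⟨ telescope (y ^ₑ k) (y ^ₑ suc k) e ⟩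
      e - y ^ₑ suc k                                ∎)
      where
        open ≡-Reasoning
        corner-subspace′ = IsSubspace.+ᵥ-closed corner-subspace (^ₑ-corner ey≡y k) eG≡G

    zero-nonunit : CornerNonUnit e 0#
    zero-nonunit = zeroʳ e , λ (w , _ , 0w≡e) → e≢0 (trans (sym 0w≡e) (zeroˡ w))

    nonunit-+ : ∀ {a b} → CornerNonUnit e a → CornerNonUnit e b → CornerNonUnit e (a + b)
    nonunit-+ {a} {b} a-nonunit@(ea≡a , _) (eb≡b , b-nonunit) =
      IsSubspace.+ᵥ-closed corner-subspace ea≡a eb≡b , a+b-nonunit
      where
        a+b-nonunit : ¬ InvertibleIn e (a + b)
        a+b-nonunit (u , eu≡u , [a+b]u≡e) = b-nonunit (u * G , corner-* G eu≡u , (begin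
          b * (u * G)          ≡⟨ *-assoc b u G ⟨
          b * u * G            ≡⟨ cong (_* G) bu≡e-au ⟩
          (e - a * u) * G      ≡⟨ [e-y]G≡e-yᴺ ⟩
          e - (a * u) ^ₑ N     ≡⟨ cong (λ z → e - z) [au]ᴺ≡0 ⟩
          e - 0#               ≡⟨ x-0≡x e ⟩
          e                    ∎))
          where
            open ≡-Reasoning
            N = proj₁ (nonunit-nilpotent a-nonunit)
            [au]ᴺ≡0 : (a * u) ^ₑ N ≡ 0#
            [au]ᴺ≡0 = trans (^ₑ-* a u N)
              (trans (cong (_* u ^ₑ N) (proj₂ (nonunit-nilpotent a-nonunit))) (zeroˡ (u ^ₑ N)))
            G = proj₁ (geometric-sum (corner-* u ea≡a) N)
            [e-y]G≡e-yᴺ = proj₂ (proj₂ (geometric-sum (corner-* u ea≡a) N))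
            bu≡e-au : b * u ≡ e - a * u
            bu≡e-au = x≈z//y (b * u) (a * u) e
              (trans (+-comm (b * u) (a * u)) (trans (sym (distribʳ u a b)) [a+b]u≡e))

    nonunit-• : ∀ c {a} → CornerNonUnit e a → CornerNonUnit e (c • a)
    nonunit-• c {a} (ea≡a , a-nonunit) = corner-• c ea≡a , λ (w , ew≡w , [ca]w≡e) →
      a-nonunit (c • w , corner-• c ew≡w , (begin
        a * (c • w)    ≡⟨ *-comm a (c • w) ⟩
        (c • w) * a    ≡⟨ •-* c w a ⟩
        c • (w * a)    ≡⟨ cong (c •_) (*-comm w a) ⟩
        c • (a * w)    ≡⟨ •-* c a w ⟨
        (c • a) * w    ≡⟨ [ca]w≡e ⟩
        e              ∎))
      where open ≡-Reasoning

    nonunit-subspace : IsSubspace (CornerNonUnit e)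
    nonunit-subspace = record { 0ᵥ∈ = zero-nonunit ; +ᵥ-closed = nonunit-+ ; •-closed = nonunit-• }

    CornerNonUnit? : Decidable (CornerNonUnit e)
    CornerNonUnit? v = Corner? e v ×-dec ¬? (InvertibleIn? e v)

    local-units : UnitsIn𝕊 e
    local-units with subspace-card (Corner? e) corner-subspace | subspace-card CornerNonUnit? nonunit-subspace
                   | card-split (InvertibleIn? e) card-eR
    ... | n₀ , card-eR′ | j , card-N | n₁ , n₂ , card-U , card-N′ , n₁+n₂≡n =
      n₁ , card-U , subst (𝕊 q) (sym n₁≡) (q^j*q^suc∸1∈𝕊 q j t)
      where
        n≡q^n₀ = card-unique card-eR card-eR′
        q^j<q^n₀ : q ^ j < q ^ n₀
        q^j<q^n₀ = subst (q ^ j <_) n≡q^n₀ (card-< CornerNonUnit? card-eR card-N proj₁ e-idem e-invertible)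
          where e-invertible = λ (_ , e-nonunit) → e-nonunit (e , e-idem , e-idem)
        j<n₀ : j < n₀
        j<n₀ = ℕ.≰⇒> λ n₀≤j → ℕ.<⇒≱ q^j<q^n₀ (ℕ.^-monoʳ-≤ q n₀≤j)
        t = n₀ ∸ suc j
        n₀≡j+1+t : n₀ ≡ j ℕ.+ suc t
        n₀≡j+1+t = sym (trans (ℕ.+-suc j t) (ℕ.m+[n∸m]≡n j<n₀))
        n₁+n₂≡q^[j+1+t] : n₁ ℕ.+ n₂ ≡ q ^ (j ℕ.+ suc t)
        n₁+n₂≡q^[j+1+t] = trans n₁+n₂≡n (trans n≡q^n₀ (cong (q ^_) n₀≡j+1+t))
        n₁≡ : n₁ ≡ q ^ j ℕ.* q^suc∸1 q t
        n₁≡ = begin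
          n₁                            ≡⟨ ℕ.m+n∸n≡m n₁ n₂ ⟨
          n₁ ℕ.+ n₂ ∸ n₂                ≡⟨ cong₂ _∸_ n₁+n₂≡q^[j+1+t] (card-unique card-N′ card-N) ⟩
          q ^ (j ℕ.+ suc t) ∸ q ^ j     ≡⟨ q^[j+1+t]∸q^j q j t ⟩
          q ^ j ℕ.* q^suc∸1 q t         ∎
          where open ≡-Reasoning

  module Split {e e′ : R} (e-idem : Idempotent e) (e′∈eR : Corner e e′) (e′-idem : Idempotent e′) where

    e″ : R
    e″ = e - e′

    e′e≡e′ : e′ * e ≡ e′
    e′e≡e′ = trans (*-comm e′ e) e′∈eR

    e′e″≡0 : e′ * e″ ≡ 0#
    e′e″≡0 = trans (x[y-z]≈xy-xz e′ e e′) (trans (cong₂ _-_ e′e≡e′ e′-idem) (-‿inverseʳ e′))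

    e″∈eR : Corner e e″
    e″∈eR = trans (x[y-z]≈xy-xz e e e′) (cong₂ _-_ e-idem e′∈eR)

    e″-idem : Idempotent e″
    e″-idem = trans ([y-z]x≈yx-zx e″ e e′) (trans (cong₂ _-_ e″∈eR e′e″≡0) (x-0≡x e″))

    e′+e″≡e : e′ + e″ ≡ e
    e′+e″≡e = trans (+-comm e′ e″) (//-rightDividesˡ e′ e)

    orthogonal : ∀ {x y} → Corner e′ x → Corner e″ y → x * y ≡ 0#
    orthogonal {x} {y} e′x≡x e″y≡y = begin
      x * y                ≡⟨ cong₂ _*_ e′x≡x e″y≡y ⟨
      (e′ * x) * (e″ * y)  ≡⟨ *-interchange e′ x e″ y ⟩
      (e′ * e″) * (x * y)  ≡⟨ cong (_* (x * y)) e′e″≡0 ⟩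
      0# * (x * y)         ≡⟨ zeroˡ (x * y) ⟩
      0#                   ∎
      where open ≡-Reasoning

    e′-projection : ∀ {a b} → Corner e′ a → Corner e″ b → e′ * (a + b) ≡ a
    e′-projection {a} {b} e′a≡a e″b≡b =
      trans (distribˡ e′ a b) (trans (cong₂ _+_ e′a≡a e′b≡0) (+-identityʳ a))
      where e′b≡0 = orthogonal e′-idem e″b≡b

    e″-projection : ∀ {a b} → Corner e′ a → Corner e″ b → e″ * (a + b) ≡ b
    e″-projection {a} {b} e′a≡a e″b≡b =
      trans (distribˡ e″ a b) (trans (cong₂ _+_ e″a≡0 e″b≡b) (+-identityˡ b))
      where e″a≡0 = trans (*-comm e″ a) (orthogonal e′a≡a e″-idem)

    e″e≡e″ : e″ * e ≡ e″
    e″e≡e″ = trans (*-comm e″ e) e″∈eR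

    UnitPair : Pred (R × R) 0ℓ
    UnitPair (a , b) = CornerUnit e′ a × CornerUnit e″ b

    units-× : ∀ {m₁ m₂} → Card (CornerUnit e′) m₁ → Card (CornerUnit e″) m₂ →
              Card (CornerUnit e) (m₁ ℕ.* m₂)
    units-× card₁ card₂ = card-map (λ (a , b) → a + b) injective into onto (card-× card₁ card₂)
      where
        open IsSubspace corner-subspace

        injective : ∀ {x y} → UnitPair x → UnitPair y → proj₁ x + proj₂ x ≡ proj₁ y + proj₂ y → x ≡ y
        injective ((e′a≡a , _) , (e″b≡b , _)) ((e′a′≡a′ , _) , (e″b′≡b′ , _)) a+b≡a′+b′ = cong₂ _,_
          (trans (sym (e′-projection e′a≡a e″b≡b)) (trans (cong (e′ *_) a+b≡a′+b′) (e′-projection e′a′≡a′ e″b′≡b′)))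
          (trans (sym (e″-projection e′a≡a e″b≡b)) (trans (cong (e″ *_) a+b≡a′+b′) (e″-projection e′a′≡a′ e″b′≡b′)))

        into : ∀ {x} → UnitPair x → CornerUnit e (proj₁ x + proj₂ x)
        into {a , b} ((e′a≡a , w₁ , e′w₁≡w₁ , aw₁≡e′) , (e″b≡b , w₂ , e″w₂≡w₂ , bw₂≡e″)) =
          +ᵥ-closed (corner-⊆ e′∈eR e′a≡a) (corner-⊆ e″∈eR e″b≡b) ,
          w₁ + w₂ , +ᵥ-closed (corner-⊆ e′∈eR e′w₁≡w₁) (corner-⊆ e″∈eR e″w₂≡w₂) , (begin
            (a + b) * (w₁ + w₂)                     ≡⟨ distribˡ (a + b) w₁ w₂ ⟩
            (a + b) * w₁ + (a + b) * w₂             ≡⟨ cong₂ _+_ (distribʳ w₁ a b) (distribʳ w₂ a b) ⟩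
            (a * w₁ + b * w₁) + (a * w₂ + b * w₂)   ≡⟨ cong₂ _+_ (cong (a * w₁ +_) bw₁≡0) (cong (_+ b * w₂) aw₂≡0) ⟩
            (a * w₁ + 0#) + (0# + b * w₂)           ≡⟨ cong₂ _+_ (+-identityʳ (a * w₁)) (+-identityˡ (b * w₂)) ⟩
            a * w₁ + b * w₂                         ≡⟨ cong₂ _+_ aw₁≡e′ bw₂≡e″ ⟩
            e′ + e″                                 ≡⟨ e′+e″≡e ⟩
            e                                       ∎)
          where
            open ≡-Reasoning
            bw₁≡0 = trans (*-comm b w₁) (orthogonal e′w₁≡w₁ e″b≡b)
            aw₂≡0 = orthogonal e′a≡a e″w₂≡w₂

        onto : ∀ {v} → CornerUnit e v → ∃ λ x → UnitPair x × proj₁ x + proj₂ x ≡ v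
        onto {v} (ev≡v , w , ew≡w , vw≡e) =
          (e′ * v , e″ * v) ,
          ((corner-* v e′-idem , e′ * w , corner-* w e′-idem , restricts e′-idem e′e≡e′) ,
           (corner-* v e″-idem , e″ * w , corner-* w e″-idem , restricts e″-idem e″e≡e″)) ,
          trans (sym (distribʳ v e′ e″)) (trans (cong (_* v) e′+e″≡e) ev≡v)
          where
            restricts : ∀ {f} → Idempotent f → f * e ≡ f → (f * v) * (f * w) ≡ f
            restricts {f} f-idem fe≡f = trans (*-interchange f v f w) (trans (cong₂ _*_ f-idem vw≡e) fe≡f)

  NontrivialIdempotentIn : R → Pred R 0ℓ
  NontrivialIdempotentIn e e′ = Corner e e′ × Idempotent e′ × e′ ≢ 0# × e′ ≢ e

  NontrivialIdempotentIn? : ∀ e → Decidable (NontrivialIdempotentIn e)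
  NontrivialIdempotentIn? e e′ =
    Corner? e e′ ×-dec (e′ * e′ ≟ᵣ e′) ×-dec ¬? (e′ ≟ᵣ 0#) ×-dec ¬? (e′ ≟ᵣ e)

  split-units : ∀ {e e′ n} → Idempotent e → Card (Corner e) n → NontrivialIdempotentIn e e′ →
                (∀ {f n′} → n′ < n → Idempotent f → Card (Corner f) n′ → UnitsIn𝕊 f) → UnitsIn𝕊 e
  split-units {e} {e′} e-idem card-eR (e′∈eR , e′-idem , e′≢0 , e′≢e) smaller-units
    with units-of e′-idem e′∈eR e′e≢e | units-of e″-idem e″∈eR e″e≢e
    where
      open Split e-idem e′∈eR e′-idem
      units-of : ∀ {f} → Idempotent f → Corner e f → f * e ≢ e → UnitsIn𝕊 f
      units-of {f} f-idem f∈eR fe≢e with card-filter (Corner? f) (card-Kⁿ d)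
      ... | _ , card-fR =
        smaller-units (card-< (Corner? f) card-eR card-fR (corner-⊆ f∈eR) e-idem fe≢e) f-idem card-fR
      e′e≢e : e′ * e ≢ e
      e′e≢e e′e≡e = e′≢e (trans (sym e′e≡e′) e′e≡e)
      e″e≢e : e″ * e ≢ e
      e″e≢e e″e≡e = e′≢0 (+-identityˡ-unique e′ e (trans (cong (e′ +_) (sym e″≡e)) e′+e″≡e))
        where e″≡e = trans (sym e″e≡e″) e″e≡e
  ... | m₁ , units₁ , 𝕊m₁ | m₂ , units₂ , 𝕊m₂ =
    m₁ ℕ.* m₂ , Split.units-× e-idem e′∈eR e′-idem units₁ units₂ , 𝕊-* 𝕊m₁ 𝕊m₂

  corner-units : ∀ N {e n} → n < N → Idempotent e → Card (Corner e) n → UnitsIn𝕊 e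
  corner-units (suc N) {e} (s≤s n≤N) e-idem card-eR with e ≟ᵣ 0# | search (NontrivialIdempotentIn? e)
  ... | yes refl | _ =
    1 , card-singleton 0# (zeroʳ 0# , 0# , zeroʳ 0# , zeroʳ 0#) (λ (0b≡b , _) → trans (sym 0b≡b) (zeroˡ _)) ,
    𝕊-1 q
  ... | no e≢0 | yes (_ , nontrivial) =
    split-units e-idem card-eR nontrivial λ n′<n → corner-units N (ℕ.<-≤-trans n′<n n≤N)
  ... | no e≢0 | no none = Local.local-units e-idem e≢0 only-trivial card-eR
    where
      only-trivial : ∀ {e′} → Corner e e′ → Idempotent e′ → e′ ≡ 0# ⊎ e′ ≡ e
      only-trivial {e′} e′∈eR e′-idem with e′ ≟ᵣ 0# | e′ ≟ᵣ e
      ... | yes e′≡0 | _        = inj₁ e′≡0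
      ... | no  _    | yes e′≡e = inj₂ e′≡e
      ... | no e′≢0  | no e′≢e  = contradiction (e′ , e′∈eR , e′-idem , e′≢0 , e′≢e) none

  Invertible : Pred R 0ℓ
  Invertible v = ∃ λ w → v * w ≡ 1#

  units-in-𝕊 : ∀ {m} → Card Invertible m → 𝕊 q m
  units-in-𝕊 card-units with card-filter (Corner? 1#) (card-Kⁿ d)
  ... | n , card-R with corner-units (suc n) ℕ.≤-refl (*-identityˡ 1#) card-R
  ...   | m , card-U , 𝕊m = subst (𝕊 q) (card-unique card-U (card-resp (into , from) card-units)) 𝕊m
    where
      into : ∀ {v} → Invertible v → CornerUnit 1# v
      into {v} (w , vw≡1) = *-identityˡ v , w , *-identityˡ w , vw≡1
      from : ∀ {v} → CornerUnit 1# v → Invertible v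
      from (_ , w , _ , vw≡1) = w , vw≡1

open import Level using (0ℓ)
open import Data.Nat using (ℕ; _≤_; _*_; zero; suc; _≤?_)
open import Data.List using (List; length; []; _∷_; deduplicate)
open import Data.List.Membership.Propositional using (_∈_)
open import Data.List.Membership.Propositional.Properties using (∈-deduplicate⁺)
open import Data.List.Relation.Unary.All as All using (All)
open import Data.List.Relation.Unary.AllPairs using ([]; _∷_)
open import Data.List.Relation.Unary.Unique.Propositional using (Unique)
import Data.List.Relation.Unary.Unique.DecPropositional.Properties as Unique
open import Data.Product using (Σ; _×_; _,_; proj₁; proj₂)
open import Relation.Binary.PropositionalEquality using (refl)
open import Relation.Nullary using (¬_)
open import Relation.Nullary.Decidable using (decidable-stable; ¬¬-excluded-middle)
open import Relation.Nullary.Negation using (¬¬-Monad)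

open Counting using (Card; mkCard; card-resp; length≤card)
open 𝕊-Numbers using (𝕊)
open Density using (𝕊-sparse)

¬¬-∀-enumerated : ∀ {A : Set} {P : A → Set} {xs : List A} →
                  (∀ x → x ∈ xs) → (∀ x → ¬ ¬ P x) → ¬ ¬ (∀ x → P x)
¬¬-∀-enumerated {xs = xs} complete ¬¬P ¬∀P =
  All.sequenceM 0ℓ ¬¬-Monad (All.tabulate {xs = xs} λ {x} _ → ¬¬P x) λ Pxs → ¬∀P λ x → All.lookup Pxs (complete x)

module PhiValues (F : FiniteField) where

  open FiniteField F using (K; 0≢1; elements; complete)
  open Poly F using (InPhiA)

  ¬¬-decidableEquality : ¬ ¬ DecidableEquality K
  ¬¬-decidableEquality = ¬¬-∀-enumerated complete λ x → ¬¬-∀-enumerated complete λ y → ¬¬-excluded-middle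

  module _ (_≟_ : DecidableEquality K) where

    q : ℕ
    q = length (deduplicate _≟_ elements)

    card-K : Card {K} U q
    card-K = mkCard (deduplicate _≟_ elements) (Unique.deduplicate-! _≟_ elements) (All.tabulate _)
               (λ {x} _ → ∈-deduplicate⁺ _≟_ (complete x)) refl

    2≤q : 2 ≤ q
    2≤q = length≤card card-K ((0≢1 All.∷ All.[]) ∷ All.[] ∷ []) (All.tabulate _)

    Φ[A]⊆𝕊 : ∀ {m} → InPhiA m → 𝕊 q m
    Φ[A]⊆𝕊 (f , zero , () , _)
    Φ[A]⊆𝕊 (f , suc d′ , _ , deg , us , unique , sound , complete′ , size) =
      units-in-𝕊 (card-resp ((λ {h} → UnitMod⇒invertible {h}) , λ {h} → invertible⇒UnitMod {h})
                                                            (mkCard us unique sound (λ {h} → complete′ h) size))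
      where
        open ResidueRing F f d′ deg
        open FiniteAlgebra F _≟_ q card-K _*ᵣ_ 1ᵣ isCommutativeAlgebra using (units-in-𝕊)

mainTheorem13 : (F : FiniteField) → (k : ℕ) → 1 ≤ k →
    Σ ℕ λ Y → (y : ℕ) → Y ≤ y → (xs : List ℕ) → Unique xs →
      All (λ m → 1 ≤ m × m ≤ y × Poly.InPhiA F m) xs →
      k * length xs ≤ y
mainTheorem13 F k _ = proj₁ (𝕊-sparse k) , bound
  where
    open PhiValues F
    bound : ∀ y → proj₁ (𝕊-sparse k) ≤ y → ∀ xs → Unique xs →
            All (λ m → 1 ≤ m × m ≤ y × Poly.InPhiA F m) xs → k * length xs ≤ y
    bound y Y≤y xs unique bounded = decidable-stable (k * length xs ≤? y) λ ¬bound →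
      ¬¬-decidableEquality λ _≟_ → ¬bound (proj₂ (𝕊-sparse k) (q _≟_) (2≤q _≟_) y Y≤y unique
        (All.map (λ (_ , m≤y , Φm) → m≤y , Φ[A]⊆𝕊 _≟_ Φm) bounded))
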